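{- For every integer $n\ge1$, \[ CP_{(2,0)}(n,X,Y)=\prod_{i=1}^{n}\frac{1-X_{i-1}X_{i}Y_{i-2}Y_{i-1}}{(1-X_{i}Y_{i-2})(1-X_{i}Y_{i-1})(1-X_{i}Y_{i})}. \]
   Context: Let $x_1,x_2,\dots,y_1,y_2,\dots$ be formal variables, $X_i:=x_1\cdots x_i$, $Y_i:=y_1\cdots y_i$ for $i\ge1$, and $X_i=Y_i:=1$ for $i\le 0$. For $n\ge1$, $CP_{(2,0)}(n,X,Y):=\sum \prod_{i=1}^n x_i^{a_i}y_i^{b_i}$, summed over all tuples of nonnegative integers $(a_1,\dots,a_n,b_1,\dots,b_n)$ with $a_1\ge\dots\ge a_n$, $b_1\ge\dots\ge b_n$, $a_j\ge b_{j}$ and $b_j\ge a_{j+2}$ for all $j\ge1$, where $a_j=b_j=0$ for $j>n$ (cylindric partitions with profile $(2,0)$ with at most $n$ nonzero entries in each row). -}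

module Defs where

open import Data.Nat as ℕ using (ℕ; zero; suc; _∸_; _≥_; _<ᵇ_)
import Data.Nat.Properties as ℕP
open import Data.Integer as ℤ using (ℤ; 0ℤ; 1ℤ)
open import Data.List using (List; []; _∷_; map; concatMap; upTo; foldr)
open import Data.Vec as Vec using (Vec; []; _∷_; tabulate; zipWith; lookup)
import Data.Vec.Properties as VecP
open import Data.Fin using (Fin; toℕ)
open import Data.Fin.Properties using (all?)
open import Data.Bool using (if_then_else_)
open import Data.Product using (_×_; _,_)
open import Relation.Nullary using (Dec; yes; no)
open import Relation.Nullary.Decidable using (_×-dec_)
open import Relation.Binary.PropositionalEquality using (_≡_)

-- Exponent vectors: a monomial in x_1..x_n, y_1..y_n is a pair (a , b)
-- of exponent vectors (position j : Fin n stands for variable index j+1).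
Mono : ℕ → Set
Mono n = Vec ℕ n × Vec ℕ n

Series : ℕ → Set
Series n = Vec ℕ n → Vec ℕ n → ℤ

sumℤ : List ℤ → ℤ
sumℤ = foldr ℤ._+_ 0ℤ

ind : {P : Set} → Dec P → ℤ
ind (yes _) = 1ℤ
ind (no _)  = 0ℤ

_≟v_ : {k : ℕ} → (u v : Vec ℕ k) → Dec (u ≡ v)
_≟v_ = VecP.≡-dec ℕP._≟_

below : {k : ℕ} → Vec ℕ k → List (Vec ℕ k)
below []      = [] ∷ []
below (x ∷ v) = concatMap (λ d → map (d ∷_) (below v)) (upTo (suc x))

_-v_ : {k : ℕ} → Vec ℕ k → Vec ℕ k → Vec ℕ k
_-v_ = zipWith _∸_

_+v_ : {k : ℕ} → Vec ℕ k → Vec ℕ k → Vec ℕ k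
_+v_ = zipWith ℕ._+_

zeroV : {k : ℕ} → Vec ℕ k
zeroV = Vec.replicate _ 0

totalV : {k : ℕ} → Vec ℕ k → ℕ
totalV = Vec.foldr _ ℕ._+_ 0

_⊛_ : {n : ℕ} → Series n → Series n → Series n
(f ⊛ g) a b =
  sumℤ (concatMap (λ da → map (λ db → f da db ℤ.* g (a -v da) (b -v db)) (below b)) (below a))

oneS : {n : ℕ} → Series n
oneS a b = ind (a ≟v zeroV ×-dec b ≟v zeroV)

oneMinus : {n : ℕ} → Mono n → Series n
oneMinus (ma , mb) a b = oneS a b ℤ.- ind (a ≟v ma ×-dec b ≟v mb)

-- the series 1/(1 - m) = Σ_{k ≥ 0} m^k (only k ≤ total degree of the target
-- monomial can contribute when m ≠ 1, which is the case for all uses below)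
geom : {n : ℕ} → Mono n → Series n
geom (ma , mb) a b =
  sumℤ (map (λ k → ind (Vec.map (k ℕ.*_) ma ≟v a ×-dec Vec.map (k ℕ.*_) mb ≟v b))
            (upTo (suc (totalV a ℕ.+ totalV b))))

-- exponent vector of the prefix product z_1 ⋯ z_k (k = 0 gives the empty product 1)
prefix : {n : ℕ} → ℕ → Vec ℕ n
prefix k = tabulate (λ j → if toℕ j <ᵇ k then 1 else 0)

-- X_i and Y_i as monomials; for i ≤ 0 they are 1 (use i ∸ 2 etc.)
Xm : {n : ℕ} → ℕ → Mono n
Xm i = prefix i , zeroV

Ym : {n : ℕ} → ℕ → Mono n
Ym i = zeroV , prefix i

_·_ : {n : ℕ} → Mono n → Mono n → Mono n
(a , b) · (c , d) = (a +v c) , (b +v d)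

factor : (n i : ℕ) → Series n
factor n i =
  oneMinus (Xm (i ∸ 1) · (Xm i · (Ym (i ∸ 2) · Ym (i ∸ 1))))
  ⊛ (geom (Xm i · Ym (i ∸ 2)) ⊛ (geom (Xm i · Ym (i ∸ 1)) ⊛ geom (Xm i · Ym i)))

RHS : (n : ℕ) → Series n
RHS n = foldr _⊛_ oneS (map (λ i → factor n (suc i)) (upTo n))

-- entries extended by 0 beyond n (0-based: ext v j = v_{j+1})
ext : {n : ℕ} → Vec ℕ n → ℕ → ℕ
ext []      _       = 0
ext (x ∷ v) zero    = x
ext (x ∷ v) (suc j) = ext v j

-- cylindric partition conditions of profile (2,0) (0-based indices j)
ValidAt : {n : ℕ} → Vec ℕ n → Vec ℕ n → Fin n → Set
ValidAt a b j' =
  let j = toℕ j' in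
  (ext a j ≥ ext a (suc j)) × (ext b j ≥ ext b (suc j)) ×
  (ext a j ≥ ext b j) × (ext b j ≥ ext a (suc (suc j)))

validAt? : {n : ℕ} (a b : Vec ℕ n) (j : Fin n) → Dec (ValidAt a b j)
validAt? a b j' =
  let j = toℕ j' in
  (ext a (suc j) ℕ.≤? ext a j) ×-dec ((ext b (suc j) ℕ.≤? ext b j) ×-dec
  ((ext b j ℕ.≤? ext a j) ×-dec (ext a (suc (suc j)) ℕ.≤? ext b j)))

Valid : {n : ℕ} → Vec ℕ n → Vec ℕ n → Set
Valid {n} a b = (j : Fin n) → ValidAt a b j

CP20 : (n : ℕ) → Series n
CP20 n a b = ind (all? (validAt? a b))

module Submission where

-- Let P_c be the series of cylindric partitions of profile (2,0) with at most c nonzero entries in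
-- each row, so that P_0 = 1 and P_n = CP_{(2,0)}(n,X,Y); the theorem telescopes once P_c times the
-- (c+1)-th factor is shown to be P_{c+1}. Multiplying by X_k Y_l (l ≤ k ≤ l + 2) adds 1 to the first
-- k entries of the a-row and the first l entries of the b-row. It maps the partitions with at most
-- k resp. l nonzero entries in the rows bijectively onto those among them whose first k resp. l
-- entries are positive. Hence (1 - X_{c+1}Y_{c+1}) P_{c+1} is the series of the partitions in
-- P_{c+1} with b_{c+1} = 0, multiplying by (1 - X_{c+1}Y_c) keeps those with a_{c+1} = 0 or b_c = 0,
-- and a case distinction on a_{c+1} and b_c shows that multiplying the result by (1 - X_{c+1}Y_{c-1})
-- gives (1 - X_c X_{c+1} Y_{c-1} Y_c) P_c. The three geometric series of the factor invert the three
-- binomials.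

open import Defs
open import Algebra.Bundles using (Monoid; CommutativeMonoid)
open import Algebra.Structures.Biased using (isCommutativeMonoidˡ)
open import Data.Bool using (if_then_else_)
open import Data.Empty using (⊥-elim)
open import Data.Fin using (toℕ; fromℕ<)
open import Data.Fin.Properties using (all?; toℕ-fromℕ<)
open import Data.Integer as ℤ using (ℤ; 0ℤ; 1ℤ; _+_; _*_; _-_)
import Data.Integer.Properties as ℤ
open import Data.Integer.Tactic.RingSolver using (solve-∀)
open import Data.List using (List; []; _∷_; _++_; map; concatMap; upTo; applyUpTo; foldr)
open import Data.List.Properties using (map-id; map-upTo)
open import Data.Nat as ℕ using (ℕ; zero; suc; _∸_; _≤_; _<_; _≥_; z≤n; s≤s; _≤′_; _<ᵇ_)
import Data.Nat.Properties as ℕ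
open import Data.Product using (_×_; _,_; proj₁; proj₂)
open import Data.Sum as Sum using (_⊎_; inj₁; inj₂; [_,_])
open import Data.Vec as Vec using (Vec; []; _∷_; tabulate)
import Data.Vec.Properties as Vec
open import Data.Vec.Relation.Binary.Pointwise.Inductive as Pointwise using (Pointwise; []; _∷_)
open import Function using (_∘_; id; _⇔_; mk⇔; Equivalence)
open import Function.Properties.Equivalence using () renaming (trans to ⇔-trans; sym to ⇔-sym)
open import Level using (0ℓ)
open import Relation.Binary.PropositionalEquality using (_≡_; _≢_; refl; sym; trans; cong; cong₂; subst; subst₂; _≗_; module ≡-Reasoning)
open import Relation.Nullary using (Dec; yes; no; ¬_)
open import Relation.Nullary.Decidable as Dec using (_×-dec_; _⊎-dec_)

ind-⇔ : {P Q : Set} (d : Dec P) (e : Dec Q) → P ⇔ Q → ind d ≡ ind e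
ind-⇔ (yes _) (yes _) _   = refl
ind-⇔ (yes p) (no ¬q) p⇔q = ⊥-elim (¬q (Equivalence.to p⇔q p))
ind-⇔ (no ¬p) (yes q) p⇔q = ⊥-elim (¬p (Equivalence.from p⇔q q))
ind-⇔ (no _)  (no _)  _   = refl

ind-yes : {P : Set} (d : Dec P) → P → ind d ≡ 1ℤ
ind-yes (yes _) _ = refl
ind-yes (no ¬p) p = ⊥-elim (¬p p)

ind-no : {P : Set} (d : Dec P) → ¬ P → ind d ≡ 0ℤ
ind-no (yes p) ¬p = ⊥-elim (¬p p)
ind-no (no _)  _  = refl

ind-× : {P Q : Set} (d : Dec P) (e : Dec Q) → ind (d ×-dec e) ≡ ind d * ind e
ind-× (yes _) (yes _) = refl
ind-× (yes _) (no _)  = refl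
ind-× (no _)  (yes _) = refl
ind-× (no _)  (no _)  = refl

ind-⊎ : {P Q R : Set} (d : Dec P) (e : Dec Q) (f : Dec R) →
        P ⇔ (Q ⊎ R) → (Q → ¬ R) → ind d ≡ ind e + ind f
ind-⊎ d (yes q) (yes r) _     q∩r = ⊥-elim (q∩r q r)
ind-⊎ d (yes q) (no _)  P⇔Q⊎R _   = ind-yes d (Equivalence.from P⇔Q⊎R (inj₁ q))
ind-⊎ d (no _)  (yes r) P⇔Q⊎R _   = ind-yes d (Equivalence.from P⇔Q⊎R (inj₂ r))
ind-⊎ d (no ¬q) (no ¬r) P⇔Q⊎R _   = ind-no d λ p → [ ¬q , ¬r ] (Equivalence.to P⇔Q⊎R p)

-- Finite sums

-- Recursive rather than sumℤ ∘ map, so that it stays folded (and unifiable) on an unknown list.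
∑ : {A : Set} → List A → (A → ℤ) → ℤ
∑ []       f = 0ℤ
∑ (x ∷ xs) f = f x + ∑ xs f

syntax ∑ xs (λ x → e) = ∑[ x ← xs ] e

∑-cong : {A : Set} (xs : List A) {f g : A → ℤ} → (∀ x → f x ≡ g x) → ∑ xs f ≡ ∑ xs g
∑-cong []       f≗g = refl
∑-cong (x ∷ xs) f≗g = cong₂ _+_ (f≗g x) (∑-cong xs f≗g)

∑-++ : {A : Set} (xs ys : List A) (f : A → ℤ) → ∑ (xs ++ ys) f ≡ ∑ xs f + ∑ ys f
∑-++ []       ys f = sym (ℤ.+-identityˡ _)
∑-++ (x ∷ xs) ys f = trans (cong (f x +_) (∑-++ xs ys f)) (sym (ℤ.+-assoc (f x) _ _))

∑-map : {A B : Set} (g : A → B) (xs : List A) (f : B → ℤ) → ∑ (map g xs) f ≡ ∑ xs (f ∘ g)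
∑-map g []       f = refl
∑-map g (x ∷ xs) f = cong (f (g x) +_) (∑-map g xs f)

∑-concatMap : {A B : Set} (g : A → List B) (xs : List A) (f : B → ℤ) →
              ∑ (concatMap g xs) f ≡ ∑[ x ← xs ] ∑ (g x) f
∑-concatMap g []       f = refl
∑-concatMap g (x ∷ xs) f = trans (∑-++ (g x) _ f) (cong (∑ (g x) f +_) (∑-concatMap g xs f))

sumℤ-map : {A : Set} (xs : List A) (f : A → ℤ) → sumℤ (map f xs) ≡ ∑ xs f
sumℤ-map []       f = refl
sumℤ-map (x ∷ xs) f = cong (f x +_) (sumℤ-map xs f)

sumℤ-concatMap : {A B : Set} (xs : List A) (ys : List B) (f : A → B → ℤ) →
                 sumℤ (concatMap (λ x → map (f x) ys) xs) ≡ ∑[ x ← xs ] ∑[ y ← ys ] f x y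
sumℤ-concatMap xs ys f = begin
  sumℤ (concatMap (λ x → map (f x) ys) xs)         ≡⟨ cong sumℤ (sym (map-id (concatMap (λ x → map (f x) ys) xs))) ⟩
  sumℤ (map id (concatMap (λ x → map (f x) ys) xs)) ≡⟨ sumℤ-map (concatMap (λ x → map (f x) ys) xs) id ⟩
  ∑ (concatMap (λ x → map (f x) ys) xs) id          ≡⟨ ∑-concatMap (λ x → map (f x) ys) xs id ⟩
  ∑[ x ← xs ] ∑ (map (f x) ys) id                   ≡⟨ ∑-cong xs (λ x → ∑-map (f x) ys id) ⟩
  ∑[ x ← xs ] ∑[ y ← ys ] f x y                     ∎
  where open ≡-Reasoning

∑-+ : {A : Set} (xs : List A) (f g : A → ℤ) → ∑[ x ← xs ] (f x + g x) ≡ ∑ xs f + ∑ xs g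
∑-+ []       f g = refl
∑-+ (x ∷ xs) f g = trans (cong (f x + g x +_) (∑-+ xs f g)) (shuffle (f x) (g x) _ _)
  where
  shuffle : ∀ a b c d → a + b + (c + d) ≡ a + c + (b + d)
  shuffle = solve-∀

∑-*ˡ : {A : Set} (xs : List A) (c : ℤ) (f : A → ℤ) → ∑[ x ← xs ] (c * f x) ≡ c * ∑ xs f
∑-*ˡ []       c f = sym (ℤ.*-zeroʳ c)
∑-*ˡ (x ∷ xs) c f = trans (cong (c * f x +_) (∑-*ˡ xs c f)) (sym (ℤ.*-distribˡ-+ c (f x) _))

∑-*ʳ : {A : Set} (xs : List A) (c : ℤ) (f : A → ℤ) → ∑[ x ← xs ] (f x * c) ≡ ∑ xs f * c
∑-*ʳ xs c f = trans (∑-cong xs λ x → ℤ.*-comm (f x) c) (trans (∑-*ˡ xs c f) (ℤ.*-comm c _))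

∑-- : {A : Set} (xs : List A) (f g : A → ℤ) → ∑[ x ← xs ] (f x - g x) ≡ ∑ xs f - ∑ xs g
∑-- []       f g = refl
∑-- (x ∷ xs) f g = trans (cong (f x - g x +_) (∑-- xs f g)) (shuffle (f x) (g x) _ _)
  where
  shuffle : ∀ a b c d → a - b + (c - d) ≡ a + c - (b + d)
  shuffle = solve-∀

∑-zero : {A : Set} (xs : List A) → ∑[ x ← xs ] 0ℤ ≡ 0ℤ
∑-zero []       = refl
∑-zero (x ∷ xs) = trans (ℤ.+-identityˡ _) (∑-zero xs)

∑-comm : {A B : Set} (xs : List A) (ys : List B) (f : A → B → ℤ) →
         ∑[ x ← xs ] ∑[ y ← ys ] f x y ≡ ∑[ y ← ys ] ∑[ x ← xs ] f x y
∑-comm []       ys f = sym (∑-zero ys)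
∑-comm (x ∷ xs) ys f = trans (cong (∑ ys (f x) +_) (∑-comm xs ys f)) (sym (∑-+ ys (f x) _))

∑≤ : ℕ → (ℕ → ℤ) → ℤ
∑≤ zero    g = g 0
∑≤ (suc x) g = g 0 + ∑≤ x (g ∘ suc)

syntax ∑≤ x (λ i → e) = ∑[ i ≤ x ] e

∑-applyUpTo : (f : ℕ → ℕ) (x : ℕ) (g : ℕ → ℤ) → ∑ (applyUpTo f (suc x)) g ≡ ∑[ i ≤ x ] g (f i)
∑-applyUpTo f zero    g = ℤ.+-identityʳ (g (f 0))
∑-applyUpTo f (suc x) g = cong (g (f 0) +_) (∑-applyUpTo (f ∘ suc) x g)

∑≤-cong : (x : ℕ) {g h : ℕ → ℤ} → (∀ i → i ≤ x → g i ≡ h i) → ∑≤ x g ≡ ∑≤ x h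
∑≤-cong zero    g≗h = g≗h 0 z≤n
∑≤-cong (suc x) g≗h = cong₂ _+_ (g≗h 0 z≤n) (∑≤-cong x λ i i≤x → g≗h (suc i) (s≤s i≤x))

∑≤-+ : (x : ℕ) (g h : ℕ → ℤ) → ∑[ i ≤ x ] (g i + h i) ≡ ∑≤ x g + ∑≤ x h
∑≤-+ x g h = begin
  ∑[ i ≤ x ] (g i + h i)                       ≡⟨ sym (∑-applyUpTo id x (λ i → g i + h i)) ⟩
  ∑[ i ← upTo (suc x) ] (g i + h i)            ≡⟨ ∑-+ (upTo (suc x)) g h ⟩
  ∑ (upTo (suc x)) g + ∑ (upTo (suc x)) h      ≡⟨ cong₂ _+_ (∑-applyUpTo id x g) (∑-applyUpTo id x h) ⟩
  ∑≤ x g + ∑≤ x h                              ∎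
  where open ≡-Reasoning

∑≤-∑-comm : {A : Set} (x : ℕ) (ys : List A) (f : ℕ → A → ℤ) →
            ∑[ i ≤ x ] ∑[ y ← ys ] f i y ≡ ∑[ y ← ys ] ∑[ i ≤ x ] f i y
∑≤-∑-comm x ys f = begin
  ∑[ i ≤ x ] ∑[ y ← ys ] f i y            ≡⟨ sym (∑-applyUpTo id x (λ i → ∑[ y ← ys ] f i y)) ⟩
  ∑[ i ← upTo (suc x) ] ∑[ y ← ys ] f i y ≡⟨ ∑-comm (upTo (suc x)) ys f ⟩
  ∑[ y ← ys ] ∑[ i ← upTo (suc x) ] f i y ≡⟨ ∑-cong ys (λ y → ∑-applyUpTo id x (λ i → f i y)) ⟩
  ∑[ y ← ys ] ∑[ i ≤ x ] f i y            ∎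
  where open ≡-Reasoning

∑≤-last : (x : ℕ) (g : ℕ → ℤ) → ∑≤ (suc x) g ≡ ∑≤ x g + g (suc x)
∑≤-last zero    g = refl
∑≤-last (suc x) g = trans (cong (g 0 +_) (∑≤-last x (g ∘ suc))) (sym (ℤ.+-assoc (g 0) _ _))

∑≤-reverse : (t : ℕ) (g : ℕ → ℤ) → ∑≤ t g ≡ ∑[ c ≤ t ] g (t ∸ c)
∑≤-reverse zero    g = refl
∑≤-reverse (suc t) g = begin
  g 0 + ∑[ c ≤ t ] g (suc c)                      ≡⟨ cong (g 0 +_) (∑≤-reverse t (g ∘ suc)) ⟩
  g 0 + ∑[ c ≤ t ] g (suc (t ∸ c))                ≡⟨ ℤ.+-comm (g 0) _ ⟩
  ∑[ c ≤ t ] g (suc (t ∸ c)) + g 0                ≡⟨ cong₂ _+_ (∑≤-cong t λ c c≤t → cong g (sym (ℕ.+-∸-assoc 1 c≤t)))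
                                                               (cong g (sym (ℕ.n∸n≡0 (suc t)))) ⟩
  ∑[ c ≤ t ] g (suc t ∸ c) + g (suc t ∸ suc t)    ≡⟨ sym (∑≤-last t (λ c → g (suc t ∸ c))) ⟩
  ∑[ c ≤ suc t ] g (suc t ∸ c)                    ∎
  where open ≡-Reasoning

∑≤-triangle : (t : ℕ) (F : ℕ → ℕ → ℤ) →
              ∑[ c ≤ t ] ∑[ d ≤ c ] F d c ≡ ∑[ d ≤ t ] ∑[ e ≤ t ∸ d ] F d (d ℕ.+ e)
∑≤-triangle zero    F = refl
∑≤-triangle (suc t) F = begin
  F 0 0 + ∑[ c ≤ t ] (F 0 (suc c) + ∑[ d ≤ c ] F (suc d) (suc c))
    ≡⟨ cong (F 0 0 +_) (∑≤-+ t (λ c → F 0 (suc c)) (λ c → ∑[ d ≤ c ] F (suc d) (suc c))) ⟩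
  F 0 0 + (∑[ c ≤ t ] F 0 (suc c) + ∑[ c ≤ t ] ∑[ d ≤ c ] F (suc d) (suc c))
    ≡⟨ sym (ℤ.+-assoc (F 0 0) _ _) ⟩
  F 0 0 + ∑[ c ≤ t ] F 0 (suc c) + ∑[ c ≤ t ] ∑[ d ≤ c ] F (suc d) (suc c)
    ≡⟨ cong (F 0 0 + ∑[ c ≤ t ] F 0 (suc c) +_) (∑≤-triangle t λ d c → F (suc d) (suc c)) ⟩
  F 0 0 + ∑[ c ≤ t ] F 0 (suc c) + ∑[ d ≤ t ] ∑[ e ≤ t ∸ d ] F (suc d) (suc (d ℕ.+ e))
    ∎
  where open ≡-Reasoning

∑≤-indicator : (x p : ℕ) (h : ℕ → ℤ) → ∑[ c ≤ x ] (ind (c ℕ.≟ p) * h c) ≡ ind (p ℕ.≤? x) * h p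
∑≤-indicator zero    zero    h = refl
∑≤-indicator zero    (suc p) h = refl
∑≤-indicator (suc x) zero    h = begin
  1ℤ * h 0 + ∑[ c ≤ x ] 0ℤ   ≡⟨ cong (1ℤ * h 0 +_) (∑≤-zero x) ⟩
  1ℤ * h 0 + 0ℤ              ≡⟨ ℤ.+-identityʳ (1ℤ * h 0) ⟩
  1ℤ * h 0                   ∎
  where
  open ≡-Reasoning
  ∑≤-zero : ∀ x → ∑[ c ≤ x ] 0ℤ ≡ 0ℤ
  ∑≤-zero zero    = refl
  ∑≤-zero (suc x) = trans (ℤ.+-identityˡ _) (∑≤-zero x)
∑≤-indicator (suc x) (suc p) h = begin
  0ℤ + ∑[ c ≤ x ] (ind (suc c ℕ.≟ suc p) * h (suc c))
    ≡⟨ ℤ.+-identityˡ _ ⟩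
  ∑[ c ≤ x ] (ind (suc c ℕ.≟ suc p) * h (suc c))
    ≡⟨ ∑≤-cong x (λ c _ → cong (_* h (suc c)) (ind-⇔ (suc c ℕ.≟ suc p) (c ℕ.≟ p) (mk⇔ ℕ.suc-injective (cong suc)))) ⟩
  ∑[ c ≤ x ] (ind (c ℕ.≟ p) * h (suc c))
    ≡⟨ ∑≤-indicator x p (h ∘ suc) ⟩
  ind (p ℕ.≤? x) * h (suc p)
    ≡⟨ cong (_* h (suc p)) (ind-⇔ (p ℕ.≤? x) (suc p ℕ.≤? suc x) (mk⇔ s≤s ℕ.≤-pred)) ⟩
  ind (suc p ℕ.≤? suc x) * h (suc p)
    ∎
  where open ≡-Reasoning

infix 4 _≤ᵥ_ _≤ᵥ?_

_≤ᵥ_ : {k : ℕ} → Vec ℕ k → Vec ℕ k → Set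
_≤ᵥ_ = Pointwise _≤_

_≤ᵥ?_ : {k : ℕ} (u v : Vec ℕ k) → Dec (u ≤ᵥ v)
_≤ᵥ?_ = Pointwise.decidable ℕ._≤?_

zeroV-≤ᵥ : {k : ℕ} (v : Vec ℕ k) → zeroV ≤ᵥ v
zeroV-≤ᵥ []      = []
zeroV-≤ᵥ (x ∷ v) = z≤n ∷ zeroV-≤ᵥ v

-v-zeroV : {k : ℕ} (v : Vec ℕ k) → v -v zeroV ≡ v
-v-zeroV []      = refl
-v-zeroV (x ∷ v) = cong (x ∷_) (-v-zeroV v)

-v-involutive : {k : ℕ} (a c : Vec ℕ k) → c ≤ᵥ a → a -v (a -v c) ≡ c
-v-involutive []      []      []          = refl
-v-involutive (x ∷ a) (y ∷ c) (y≤x ∷ c≤a) = cong₂ _∷_ (ℕ.m∸[m∸n]≡n y≤x) (-v-involutive a c c≤a)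

+v--v : {k : ℕ} (d e : Vec ℕ k) → (d +v e) -v d ≡ e
+v--v []      []      = refl
+v--v (x ∷ d) (y ∷ e) = cong₂ _∷_ (ℕ.m+n∸m≡n x y) (+v--v d e)

-v-+v : {k : ℕ} (a d e : Vec ℕ k) → a -v (d +v e) ≡ (a -v d) -v e
-v-+v []      []      []      = refl
-v-+v (x ∷ a) (y ∷ d) (z ∷ e) = cong₂ _∷_ (sym (ℕ.∸-+-assoc x y z)) (-v-+v a d e)

∑≤ᵥ : {k : ℕ} → Vec ℕ k → (Vec ℕ k → ℤ) → ℤ
∑≤ᵥ v f = ∑ (below v) f

syntax ∑≤ᵥ v (λ w → e) = ∑[ w ≤ᵥ v ] e

∑≤ᵥ-[] : (f : Vec ℕ 0 → ℤ) → ∑≤ᵥ [] f ≡ f []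
∑≤ᵥ-[] f = ℤ.+-identityʳ (f [])

∑≤ᵥ-∷ : {k : ℕ} (x : ℕ) (v : Vec ℕ k) (f : Vec ℕ (suc k) → ℤ) →
        ∑≤ᵥ (x ∷ v) f ≡ ∑[ d ≤ x ] ∑[ w ≤ᵥ v ] f (d ∷ w)
∑≤ᵥ-∷ x v f = begin
  ∑ (concatMap (λ d → map (d ∷_) (below v)) (upTo (suc x))) f  ≡⟨ ∑-concatMap (λ d → map (d ∷_) (below v)) (upTo (suc x)) f ⟩
  ∑[ d ← upTo (suc x) ] ∑ (map (d ∷_) (below v)) f             ≡⟨ ∑-cong (upTo (suc x)) (λ d → ∑-map (d ∷_) (below v) f) ⟩
  ∑[ d ← upTo (suc x) ] ∑[ w ≤ᵥ v ] f (d ∷ w)                  ≡⟨ ∑-applyUpTo id x (λ d → ∑[ w ≤ᵥ v ] f (d ∷ w)) ⟩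
  ∑[ d ≤ x ] ∑[ w ≤ᵥ v ] f (d ∷ w)                             ∎
  where open ≡-Reasoning

∑≤ᵥ-cong : {k : ℕ} (v : Vec ℕ k) {f g : Vec ℕ k → ℤ} → (∀ w → w ≤ᵥ v → f w ≡ g w) → ∑≤ᵥ v f ≡ ∑≤ᵥ v g
∑≤ᵥ-cong []      {f} {g} f≗g = trans (∑≤ᵥ-[] f) (trans (f≗g [] []) (sym (∑≤ᵥ-[] g)))
∑≤ᵥ-cong (x ∷ v) {f} {g} f≗g = begin
  ∑≤ᵥ (x ∷ v) f                     ≡⟨ ∑≤ᵥ-∷ x v f ⟩
  ∑[ d ≤ x ] ∑[ w ≤ᵥ v ] f (d ∷ w)  ≡⟨ ∑≤-cong x (λ d d≤x → ∑≤ᵥ-cong v λ w w≤v → f≗g (d ∷ w) (d≤x ∷ w≤v)) ⟩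
  ∑[ d ≤ x ] ∑[ w ≤ᵥ v ] g (d ∷ w)  ≡⟨ sym (∑≤ᵥ-∷ x v g) ⟩
  ∑≤ᵥ (x ∷ v) g                     ∎
  where open ≡-Reasoning

∑≤ᵥ-triangle : {k : ℕ} (t : Vec ℕ k) (F : Vec ℕ k → Vec ℕ k → ℤ) →
               ∑[ c ≤ᵥ t ] ∑[ d ≤ᵥ c ] F d c ≡ ∑[ d ≤ᵥ t ] ∑[ e ≤ᵥ t -v d ] F d (d +v e)
∑≤ᵥ-triangle [] F = begin
  ∑[ c ≤ᵥ [] ] ∑[ d ≤ᵥ c ] F d c              ≡⟨ ∑≤ᵥ-[] (λ c → ∑[ d ≤ᵥ c ] F d c) ⟩
  ∑[ d ≤ᵥ [] ] F d []                          ≡⟨ ∑≤ᵥ-[] (λ d → F d []) ⟩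
  F [] []                                      ≡⟨ sym (∑≤ᵥ-[] (F [])) ⟩
  ∑[ e ≤ᵥ [] ] F [] e                          ≡⟨ sym (∑≤ᵥ-[] (λ d → ∑[ e ≤ᵥ [] -v d ] F d (d +v e))) ⟩
  ∑[ d ≤ᵥ [] ] ∑[ e ≤ᵥ [] -v d ] F d (d +v e)  ∎
  where open ≡-Reasoning
∑≤ᵥ-triangle (x ∷ t) F = begin
  ∑[ c ≤ᵥ x ∷ t ] ∑[ d ≤ᵥ c ] F d c
    ≡⟨ ∑≤ᵥ-∷ x t _ ⟩
  ∑[ c₀ ≤ x ] ∑[ c ≤ᵥ t ] ∑[ d ≤ᵥ c₀ ∷ c ] F d (c₀ ∷ c)
    ≡⟨ ∑≤-cong x (λ c₀ _ → ∑-cong (below t) λ c → ∑≤ᵥ-∷ c₀ c _) ⟩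
  ∑[ c₀ ≤ x ] ∑[ c ≤ᵥ t ] ∑[ d₀ ≤ c₀ ] ∑[ d ≤ᵥ c ] F (d₀ ∷ d) (c₀ ∷ c)
    ≡⟨ ∑≤-cong x (λ c₀ _ → sym (∑≤-∑-comm c₀ (below t) _)) ⟩
  ∑[ c₀ ≤ x ] ∑[ d₀ ≤ c₀ ] ∑[ c ≤ᵥ t ] ∑[ d ≤ᵥ c ] F (d₀ ∷ d) (c₀ ∷ c)
    ≡⟨ ∑≤-cong x (λ c₀ _ → ∑≤-cong c₀ λ d₀ _ → ∑≤ᵥ-triangle t _) ⟩
  ∑[ c₀ ≤ x ] ∑[ d₀ ≤ c₀ ] ∑[ d ≤ᵥ t ] ∑[ e ≤ᵥ t -v d ] F (d₀ ∷ d) (c₀ ∷ (d +v e))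
    ≡⟨ ∑≤-triangle x _ ⟩
  ∑[ d₀ ≤ x ] ∑[ e₀ ≤ x ∸ d₀ ] ∑[ d ≤ᵥ t ] ∑[ e ≤ᵥ t -v d ] F (d₀ ∷ d) ((d₀ ℕ.+ e₀) ∷ (d +v e))
    ≡⟨ ∑≤-cong x (λ d₀ _ → ∑≤-∑-comm (x ∸ d₀) (below t) _) ⟩
  ∑[ d₀ ≤ x ] ∑[ d ≤ᵥ t ] ∑[ e₀ ≤ x ∸ d₀ ] ∑[ e ≤ᵥ t -v d ] F (d₀ ∷ d) ((d₀ ℕ.+ e₀) ∷ (d +v e))
    ≡⟨ ∑≤-cong x (λ d₀ _ → ∑-cong (below t) λ d → sym (∑≤ᵥ-∷ (x ∸ d₀) (t -v d) _)) ⟩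
  ∑[ d₀ ≤ x ] ∑[ d ≤ᵥ t ] ∑[ e ≤ᵥ (x ∷ t) -v (d₀ ∷ d) ] F (d₀ ∷ d) ((d₀ ∷ d) +v e)
    ≡⟨ sym (∑≤ᵥ-∷ x t _) ⟩
  ∑[ d ≤ᵥ x ∷ t ] ∑[ e ≤ᵥ (x ∷ t) -v d ] F d (d +v e)
    ∎
  where open ≡-Reasoning

∑≤ᵥ-reverse : {k : ℕ} (t : Vec ℕ k) (f : Vec ℕ k → ℤ) → ∑≤ᵥ t f ≡ ∑[ c ≤ᵥ t ] f (t -v c)
∑≤ᵥ-reverse []      f = trans (∑≤ᵥ-[] f) (sym (∑≤ᵥ-[] (λ c → f ([] -v c))))
∑≤ᵥ-reverse (x ∷ t) f = begin
  ∑≤ᵥ (x ∷ t) f                                    ≡⟨ ∑≤ᵥ-∷ x t f ⟩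
  ∑[ c₀ ≤ x ] ∑[ c ≤ᵥ t ] f (c₀ ∷ c)               ≡⟨ ∑≤-cong x (λ c₀ _ → ∑≤ᵥ-reverse t _) ⟩
  ∑[ c₀ ≤ x ] ∑[ c ≤ᵥ t ] f (c₀ ∷ (t -v c))        ≡⟨ ∑≤-reverse x _ ⟩
  ∑[ c₀ ≤ x ] ∑[ c ≤ᵥ t ] f ((x ∸ c₀) ∷ (t -v c))  ≡⟨ sym (∑≤ᵥ-∷ x t _) ⟩
  ∑[ c ≤ᵥ x ∷ t ] f ((x ∷ t) -v c)                 ∎
  where open ≡-Reasoning

∑≤ᵥ-indicator : {k : ℕ} (t p : Vec ℕ k) (h : Vec ℕ k → ℤ) →
                ∑[ c ≤ᵥ t ] (ind (c ≟v p) * h c) ≡ ind (p ≤ᵥ? t) * h p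
∑≤ᵥ-indicator []      []      h = ∑≤ᵥ-[] (λ c → ind (c ≟v []) * h c)
∑≤ᵥ-indicator (x ∷ t) (p ∷ q) h = begin
  ∑[ c ≤ᵥ x ∷ t ] (ind (c ≟v (p ∷ q)) * h c)
    ≡⟨ ∑≤ᵥ-∷ x t _ ⟩
  ∑[ c₀ ≤ x ] ∑[ c ≤ᵥ t ] (ind ((c₀ ∷ c) ≟v (p ∷ q)) * h (c₀ ∷ c))
    ≡⟨ ∑≤-cong x (λ c₀ _ → ∑-cong (below t) λ c → split-head c₀ c) ⟩
  ∑[ c₀ ≤ x ] ∑[ c ≤ᵥ t ] (ind (c₀ ℕ.≟ p) * (ind (c ≟v q) * h (c₀ ∷ c)))
    ≡⟨ ∑≤-cong x (λ c₀ _ → ∑-*ˡ (below t) (ind (c₀ ℕ.≟ p)) _) ⟩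
  ∑[ c₀ ≤ x ] (ind (c₀ ℕ.≟ p) * ∑[ c ≤ᵥ t ] (ind (c ≟v q) * h (c₀ ∷ c)))
    ≡⟨ ∑≤-cong x (λ c₀ _ → cong (ind (c₀ ℕ.≟ p) *_) (∑≤ᵥ-indicator t q _)) ⟩
  ∑[ c₀ ≤ x ] (ind (c₀ ℕ.≟ p) * (ind (q ≤ᵥ? t) * h (c₀ ∷ q)))
    ≡⟨ ∑≤-indicator x p _ ⟩
  ind (p ℕ.≤? x) * (ind (q ≤ᵥ? t) * h (p ∷ q))
    ≡⟨ sym (ℤ.*-assoc (ind (p ℕ.≤? x)) _ _) ⟩
  ind (p ℕ.≤? x) * ind (q ≤ᵥ? t) * h (p ∷ q)
    ≡⟨ cong (_* h (p ∷ q)) (trans (sym (ind-× (p ℕ.≤? x) (q ≤ᵥ? t))) (ind-⇔ _ ((p ∷ q) ≤ᵥ? (x ∷ t)) ∷-⇔)) ⟩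
  ind ((p ∷ q) ≤ᵥ? (x ∷ t)) * h (p ∷ q)
    ∎
  where
  open ≡-Reasoning
  ∷-⇔ : (p ≤ x × q ≤ᵥ t) ⇔ ((p ∷ q) ≤ᵥ (x ∷ t))
  ∷-⇔ = mk⇔ (λ (p≤x , q≤t) → p≤x ∷ q≤t) λ { (p≤x ∷ q≤t) → p≤x , q≤t }
  split-head : ∀ c₀ c → ind ((c₀ ∷ c) ≟v (p ∷ q)) * h (c₀ ∷ c) ≡ ind (c₀ ℕ.≟ p) * (ind (c ≟v q) * h (c₀ ∷ c))
  split-head c₀ c = begin
    ind ((c₀ ∷ c) ≟v (p ∷ q)) * h (c₀ ∷ c)
      ≡⟨ cong (_* h (c₀ ∷ c)) (ind-⇔ ((c₀ ∷ c) ≟v (p ∷ q)) ((c₀ ℕ.≟ p) ×-dec (c ≟v q))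
                                     (mk⇔ Vec.∷-injective λ { (refl , refl) → refl })) ⟩
    ind ((c₀ ℕ.≟ p) ×-dec (c ≟v q)) * h (c₀ ∷ c)
      ≡⟨ cong (_* h (c₀ ∷ c)) (ind-× (c₀ ℕ.≟ p) (c ≟v q)) ⟩
    ind (c₀ ℕ.≟ p) * ind (c ≟v q) * h (c₀ ∷ c)
      ≡⟨ ℤ.*-assoc (ind (c₀ ℕ.≟ p)) _ _ ⟩
    ind (c₀ ℕ.≟ p) * (ind (c ≟v q) * h (c₀ ∷ c))
      ∎

-- Formal power series

infix 4 _≐_

_≐_ : {n : ℕ} → Series n → Series n → Set
f ≐ g = ∀ a b → f a b ≡ g a b

-- oneS is monomial (zeroV , zeroV) and oneMinus m is oneS minus monomial m, definitionally.
monomial : {n : ℕ} → Mono n → Series n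
monomial (ma , mb) a b = ind (a ≟v ma ×-dec b ≟v mb)

⊛-def : {n : ℕ} (f g : Series n) (a b : Vec ℕ n) →
        (f ⊛ g) a b ≡ ∑[ da ≤ᵥ a ] ∑[ db ≤ᵥ b ] (f da db * g (a -v da) (b -v db))
⊛-def f g a b = sumℤ-concatMap (below a) (below b) (λ da db → f da db * g (a -v da) (b -v db))

⊛-cong : {n : ℕ} {f f′ g g′ : Series n} → f ≐ f′ → g ≐ g′ → (f ⊛ g) ≐ (f′ ⊛ g′)
⊛-cong {f = f} {f′} {g} {g′} f≐f′ g≐g′ a b = begin
  (f ⊛ g) a b
    ≡⟨ ⊛-def f g a b ⟩
  ∑[ da ≤ᵥ a ] ∑[ db ≤ᵥ b ] (f da db * g (a -v da) (b -v db))
    ≡⟨ ∑-cong (below a) (λ da → ∑-cong (below b) λ db → cong₂ _*_ (f≐f′ da db) (g≐g′ (a -v da) (b -v db))) ⟩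
  ∑[ da ≤ᵥ a ] ∑[ db ≤ᵥ b ] (f′ da db * g′ (a -v da) (b -v db))
    ≡⟨ sym (⊛-def f′ g′ a b) ⟩
  (f′ ⊛ g′) a b
    ∎
  where open ≡-Reasoning

⊛-distribʳ-- : {n : ℕ} (f g h : Series n) (a b : Vec ℕ n) →
               ((λ a b → f a b - g a b) ⊛ h) a b ≡ (f ⊛ h) a b - (g ⊛ h) a b
⊛-distribʳ-- f g h a b = begin
  ((λ a b → f a b - g a b) ⊛ h) a b
    ≡⟨ ⊛-def (λ a b → f a b - g a b) h a b ⟩
  ∑[ da ≤ᵥ a ] ∑[ db ≤ᵥ b ] ((f da db - g da db) * h (a -v da) (b -v db))
    ≡⟨ ∑-cong (below a) (λ da → ∑-cong (below b) λ db → distrib (f da db) (g da db) (h (a -v da) (b -v db))) ⟩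
  ∑[ da ≤ᵥ a ] ∑[ db ≤ᵥ b ] (f da db * h (a -v da) (b -v db) - g da db * h (a -v da) (b -v db))
    ≡⟨ ∑-cong (below a) (λ da → ∑-- (below b) _ _) ⟩
  ∑[ da ≤ᵥ a ] (∑[ db ≤ᵥ b ] (f da db * h (a -v da) (b -v db)) - ∑[ db ≤ᵥ b ] (g da db * h (a -v da) (b -v db)))
    ≡⟨ ∑-- (below a) _ _ ⟩
  ∑[ da ≤ᵥ a ] ∑[ db ≤ᵥ b ] (f da db * h (a -v da) (b -v db)) - ∑[ da ≤ᵥ a ] ∑[ db ≤ᵥ b ] (g da db * h (a -v da) (b -v db))
    ≡⟨ sym (cong₂ _-_ (⊛-def f h a b) (⊛-def g h a b)) ⟩
  (f ⊛ h) a b - (g ⊛ h) a b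
    ∎
  where
  open ≡-Reasoning
  distrib : ∀ u v w → (u - v) * w ≡ u * w - v * w
  distrib = solve-∀

monomial-⊛ : {n : ℕ} (ma mb : Vec ℕ n) (h : Series n) (a b : Vec ℕ n) →
             (monomial (ma , mb) ⊛ h) a b ≡ ind (ma ≤ᵥ? a) * ind (mb ≤ᵥ? b) * h (a -v ma) (b -v mb)
monomial-⊛ ma mb h a b = begin
  (monomial (ma , mb) ⊛ h) a b
    ≡⟨ ⊛-def (monomial (ma , mb)) h a b ⟩
  ∑[ da ≤ᵥ a ] ∑[ db ≤ᵥ b ] (ind (da ≟v ma ×-dec db ≟v mb) * h (a -v da) (b -v db))
    ≡⟨ ∑-cong (below a) (λ da → ∑-cong (below b) λ db → split da db) ⟩
  ∑[ da ≤ᵥ a ] ∑[ db ≤ᵥ b ] (ind (da ≟v ma) * (ind (db ≟v mb) * h (a -v da) (b -v db)))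
    ≡⟨ ∑-cong (below a) (λ da → ∑-*ˡ (below b) (ind (da ≟v ma)) _) ⟩
  ∑[ da ≤ᵥ a ] (ind (da ≟v ma) * ∑[ db ≤ᵥ b ] (ind (db ≟v mb) * h (a -v da) (b -v db)))
    ≡⟨ ∑≤ᵥ-indicator a ma _ ⟩
  ind (ma ≤ᵥ? a) * ∑[ db ≤ᵥ b ] (ind (db ≟v mb) * h (a -v ma) (b -v db))
    ≡⟨ cong (ind (ma ≤ᵥ? a) *_) (∑≤ᵥ-indicator b mb _) ⟩
  ind (ma ≤ᵥ? a) * (ind (mb ≤ᵥ? b) * h (a -v ma) (b -v mb))
    ≡⟨ sym (ℤ.*-assoc (ind (ma ≤ᵥ? a)) _ _) ⟩
  ind (ma ≤ᵥ? a) * ind (mb ≤ᵥ? b) * h (a -v ma) (b -v mb)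
    ∎
  where
  open ≡-Reasoning
  split : ∀ da db → ind (da ≟v ma ×-dec db ≟v mb) * h (a -v da) (b -v db)
                  ≡ ind (da ≟v ma) * (ind (db ≟v mb) * h (a -v da) (b -v db))
  split da db = trans (cong (_* h (a -v da) (b -v db)) (ind-× (da ≟v ma) (db ≟v mb))) (ℤ.*-assoc (ind (da ≟v ma)) _ _)

⊛-identityˡ : {n : ℕ} (h : Series n) → (oneS ⊛ h) ≐ h
⊛-identityˡ h a b = begin
  (oneS ⊛ h) a b
    ≡⟨ monomial-⊛ zeroV zeroV h a b ⟩
  ind (zeroV ≤ᵥ? a) * ind (zeroV ≤ᵥ? b) * h (a -v zeroV) (b -v zeroV)
    ≡⟨ cong₂ _*_ (cong₂ _*_ (ind-yes (zeroV ≤ᵥ? a) (zeroV-≤ᵥ a)) (ind-yes (zeroV ≤ᵥ? b) (zeroV-≤ᵥ b)))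
                 (cong₂ h (-v-zeroV a) (-v-zeroV b)) ⟩
  1ℤ * h a b
    ≡⟨ ℤ.*-identityˡ (h a b) ⟩
  h a b
    ∎
  where open ≡-Reasoning

oneMinus-⊛ : {n : ℕ} (ma mb : Vec ℕ n) (h : Series n) (a b : Vec ℕ n) →
             (oneMinus (ma , mb) ⊛ h) a b ≡ h a b - ind (ma ≤ᵥ? a) * ind (mb ≤ᵥ? b) * h (a -v ma) (b -v mb)
oneMinus-⊛ ma mb h a b = trans (⊛-distribʳ-- oneS (monomial (ma , mb)) h a b)
                               (cong₂ _-_ (⊛-identityˡ h a b) (monomial-⊛ ma mb h a b))

⊛-comm : {n : ℕ} (f g : Series n) → (f ⊛ g) ≐ (g ⊛ f)
⊛-comm f g a b = begin
  (f ⊛ g) a b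
    ≡⟨ ⊛-def f g a b ⟩
  ∑[ da ≤ᵥ a ] ∑[ db ≤ᵥ b ] (f da db * g (a -v da) (b -v db))
    ≡⟨ ∑-cong (below a) (λ da → ∑≤ᵥ-reverse b _) ⟩
  ∑[ da ≤ᵥ a ] ∑[ db ≤ᵥ b ] (f da (b -v db) * g (a -v da) (b -v (b -v db)))
    ≡⟨ ∑≤ᵥ-reverse a _ ⟩
  ∑[ da ≤ᵥ a ] ∑[ db ≤ᵥ b ] (f (a -v da) (b -v db) * g (a -v (a -v da)) (b -v (b -v db)))
    ≡⟨ ∑≤ᵥ-cong a (λ da da≤a → ∑≤ᵥ-cong b λ db db≤b → swap da db da≤a db≤b) ⟩
  ∑[ da ≤ᵥ a ] ∑[ db ≤ᵥ b ] (g da db * f (a -v da) (b -v db))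
    ≡⟨ sym (⊛-def g f a b) ⟩
  (g ⊛ f) a b
    ∎
  where
  open ≡-Reasoning
  swap : ∀ da db → da ≤ᵥ a → db ≤ᵥ b →
         f (a -v da) (b -v db) * g (a -v (a -v da)) (b -v (b -v db)) ≡ g da db * f (a -v da) (b -v db)
  swap da db da≤a db≤b = trans (cong₂ (λ u v → f (a -v da) (b -v db) * g u v) (-v-involutive a da da≤a) (-v-involutive b db db≤b))
                               (ℤ.*-comm (f (a -v da) (b -v db)) (g da db))

⊛-assoc : {n : ℕ} (f g h : Series n) → ((f ⊛ g) ⊛ h) ≐ (f ⊛ (g ⊛ h))
⊛-assoc f g h a b = begin
  ((f ⊛ g) ⊛ h) a b
    ≡⟨ ⊛-def (f ⊛ g) h a b ⟩
  ∑[ ca ≤ᵥ a ] ∑[ cb ≤ᵥ b ] ((f ⊛ g) ca cb * h (a -v ca) (b -v cb))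
    ≡⟨ ∑-cong (below a) (λ ca → ∑-cong (below b) λ cb → expand ca cb) ⟩
  ∑[ ca ≤ᵥ a ] ∑[ cb ≤ᵥ b ] ∑[ da ≤ᵥ ca ] ∑[ db ≤ᵥ cb ] (f da db * g (ca -v da) (cb -v db) * h (a -v ca) (b -v cb))
    ≡⟨ ∑-cong (below a) (λ ca → ∑-comm (below b) (below ca) _) ⟩
  ∑[ ca ≤ᵥ a ] ∑[ da ≤ᵥ ca ] ∑[ cb ≤ᵥ b ] ∑[ db ≤ᵥ cb ] (f da db * g (ca -v da) (cb -v db) * h (a -v ca) (b -v cb))
    ≡⟨ ∑-cong (below a) (λ ca → ∑-cong (below ca) λ da → ∑≤ᵥ-triangle b _) ⟩
  ∑[ ca ≤ᵥ a ] ∑[ da ≤ᵥ ca ] ∑[ db ≤ᵥ b ] ∑[ eb ≤ᵥ b -v db ]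
    (f da db * g (ca -v da) ((db +v eb) -v db) * h (a -v ca) (b -v (db +v eb)))
    ≡⟨ ∑≤ᵥ-triangle a _ ⟩
  ∑[ da ≤ᵥ a ] ∑[ ea ≤ᵥ a -v da ] ∑[ db ≤ᵥ b ] ∑[ eb ≤ᵥ b -v db ]
    (f da db * g ((da +v ea) -v da) ((db +v eb) -v db) * h (a -v (da +v ea)) (b -v (db +v eb)))
    ≡⟨ ∑-cong (below a) (λ da → ∑-cong (below (a -v da)) λ ea → ∑-cong (below b) λ db → ∑-cong (below (b -v db)) λ eb →
         reindex da ea db eb) ⟩
  ∑[ da ≤ᵥ a ] ∑[ ea ≤ᵥ a -v da ] ∑[ db ≤ᵥ b ] ∑[ eb ≤ᵥ b -v db ]
    (f da db * (g ea eb * h ((a -v da) -v ea) ((b -v db) -v eb)))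
    ≡⟨ ∑-cong (below a) (λ da → ∑-comm (below (a -v da)) (below b) _) ⟩
  ∑[ da ≤ᵥ a ] ∑[ db ≤ᵥ b ] ∑[ ea ≤ᵥ a -v da ] ∑[ eb ≤ᵥ b -v db ]
    (f da db * (g ea eb * h ((a -v da) -v ea) ((b -v db) -v eb)))
    ≡⟨ ∑-cong (below a) (λ da → ∑-cong (below b) λ db → collapse da db) ⟩
  ∑[ da ≤ᵥ a ] ∑[ db ≤ᵥ b ] (f da db * (g ⊛ h) (a -v da) (b -v db))
    ≡⟨ sym (⊛-def f (g ⊛ h) a b) ⟩
  (f ⊛ (g ⊛ h)) a b
    ∎
  where
  open ≡-Reasoning
  expand : ∀ ca cb → (f ⊛ g) ca cb * h (a -v ca) (b -v cb)
                   ≡ ∑[ da ≤ᵥ ca ] ∑[ db ≤ᵥ cb ] (f da db * g (ca -v da) (cb -v db) * h (a -v ca) (b -v cb))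
  expand ca cb = begin
    (f ⊛ g) ca cb * h (a -v ca) (b -v cb)
      ≡⟨ cong (_* h (a -v ca) (b -v cb)) (⊛-def f g ca cb) ⟩
    ∑[ da ≤ᵥ ca ] ∑[ db ≤ᵥ cb ] (f da db * g (ca -v da) (cb -v db)) * h (a -v ca) (b -v cb)
      ≡⟨ sym (∑-*ʳ (below ca) _ _) ⟩
    ∑[ da ≤ᵥ ca ] (∑[ db ≤ᵥ cb ] (f da db * g (ca -v da) (cb -v db)) * h (a -v ca) (b -v cb))
      ≡⟨ ∑-cong (below ca) (λ da → sym (∑-*ʳ (below cb) _ _)) ⟩
    ∑[ da ≤ᵥ ca ] ∑[ db ≤ᵥ cb ] (f da db * g (ca -v da) (cb -v db) * h (a -v ca) (b -v cb))
      ∎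
  reindex : ∀ da ea db eb →
            f da db * g ((da +v ea) -v da) ((db +v eb) -v db) * h (a -v (da +v ea)) (b -v (db +v eb))
            ≡ f da db * (g ea eb * h ((a -v da) -v ea) ((b -v db) -v eb))
  reindex da ea db eb = trans (cong₂ (λ u v → f da db * u * v) (cong₂ g (+v--v da ea) (+v--v db eb)) (cong₂ h (-v-+v a da ea) (-v-+v b db eb)))
                              (ℤ.*-assoc (f da db) _ _)
  collapse : ∀ da db → ∑[ ea ≤ᵥ a -v da ] ∑[ eb ≤ᵥ b -v db ] (f da db * (g ea eb * h ((a -v da) -v ea) ((b -v db) -v eb)))
                       ≡ f da db * (g ⊛ h) (a -v da) (b -v db)
  collapse da db = begin
    ∑[ ea ≤ᵥ a -v da ] ∑[ eb ≤ᵥ b -v db ] (f da db * (g ea eb * h ((a -v da) -v ea) ((b -v db) -v eb)))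
      ≡⟨ ∑-cong (below (a -v da)) (λ ea → ∑-*ˡ (below (b -v db)) (f da db) _) ⟩
    ∑[ ea ≤ᵥ a -v da ] (f da db * ∑[ eb ≤ᵥ b -v db ] (g ea eb * h ((a -v da) -v ea) ((b -v db) -v eb)))
      ≡⟨ ∑-*ˡ (below (a -v da)) (f da db) _ ⟩
    f da db * ∑[ ea ≤ᵥ a -v da ] ∑[ eb ≤ᵥ b -v db ] (g ea eb * h ((a -v da) -v ea) ((b -v db) -v eb))
      ≡⟨ cong (f da db *_) (sym (⊛-def g h (a -v da) (b -v db))) ⟩
    f da db * (g ⊛ h) (a -v da) (b -v db)
      ∎

⊛-commutativeMonoid : ℕ → CommutativeMonoid 0ℓ 0ℓ
⊛-commutativeMonoid n = record
  { Carrier             = Series n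
  ; _≈_                 = _≐_
  ; _∙_                 = _⊛_
  ; ε                   = oneS
  ; isCommutativeMonoid = isCommutativeMonoidˡ record
    { isSemigroup = record
      { isMagma = record
        { isEquivalence = record
          { refl  = λ _ _ → refl
          ; sym   = λ f≐g a b → sym (f≐g a b)
          ; trans = λ f≐g g≐h a b → trans (f≐g a b) (g≐h a b)
          }
        ; ∙-cong = ⊛-cong
        }
      ; assoc = ⊛-assoc
      }
    ; identityˡ = ⊛-identityˡ
    ; comm      = ⊛-comm
    }
  }

scale : {k : ℕ} → ℕ → Vec ℕ k → Vec ℕ k
scale t = Vec.map (t ℕ.*_)

scale-zero : {k : ℕ} (m : Vec ℕ k) → scale 0 m ≡ zeroV
scale-zero []      = refl
scale-zero (x ∷ m) = cong (0 ∷_) (scale-zero m)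

scale-suc : {k : ℕ} (t : ℕ) (m a : Vec ℕ k) → (scale (suc t) m ≡ a) ⇔ (m ≤ᵥ a × scale t m ≡ a -v m)
scale-suc t m a = mk⇔ (to m a) (from m a)
  where
  to : ∀ {k} (m a : Vec ℕ k) → scale (suc t) m ≡ a → m ≤ᵥ a × scale t m ≡ a -v m
  to []      []      _    = [] , refl
  to (x ∷ m) (._ ∷ a) eq with refl ← Vec.∷-injectiveˡ eq with m≤a , tm≡a-m ← to m a (Vec.∷-injectiveʳ eq) =
    ℕ.m≤m+n x (t ℕ.* x) ∷ m≤a , cong₂ _∷_ (sym (ℕ.m+n∸m≡n x (t ℕ.* x))) tm≡a-m
  from : ∀ {k} (m a : Vec ℕ k) → m ≤ᵥ a × scale t m ≡ a -v m → scale (suc t) m ≡ a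
  from []      []      _                     = refl
  from (x ∷ m) (y ∷ a) (x≤y ∷ m≤a , tm≡a-m) =
    cong₂ _∷_ (trans (cong (x ℕ.+_) (Vec.∷-injectiveˡ tm≡a-m)) (ℕ.m+[n∸m]≡n x≤y)) (from m a (m≤a , Vec.∷-injectiveʳ tm≡a-m))

IsPower : {n : ℕ} → Mono n → ℕ → Vec ℕ n → Vec ℕ n → Set
IsPower (ma , mb) t a b = scale t ma ≡ a × scale t mb ≡ b

isPower? : {n : ℕ} (m : Mono n) (t : ℕ) (a b : Vec ℕ n) → Dec (IsPower m t a b)
isPower? (ma , mb) t a b = scale t ma ≟v a ×-dec scale t mb ≟v b

geom-at : {n : ℕ} (ma : Vec ℕ n) (mb : Vec ℕ (suc n)) (x : ℕ) (a : Vec ℕ n) (b : Vec ℕ (suc n)) →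
          geom (1 ∷ ma , mb) (x ∷ a) b ≡ ind (isPower? (1 ∷ ma , mb) x (x ∷ a) b)
geom-at ma mb x a b = begin
  sumℤ (map G (upTo (suc T)))   ≡⟨ sumℤ-map (upTo (suc T)) G ⟩
  ∑ (upTo (suc T)) G            ≡⟨ ∑-applyUpTo id T G ⟩
  ∑[ t ≤ T ] G t                ≡⟨ ∑≤-cong T (λ t _ → only-x t) ⟩
  ∑[ t ≤ T ] (ind (t ℕ.≟ x) * G x)  ≡⟨ ∑≤-indicator T x (λ _ → G x) ⟩
  ind (x ℕ.≤? T) * G x          ≡⟨ cong (_* G x) (ind-yes (x ℕ.≤? T) (ℕ.≤-trans (ℕ.m≤m+n x _) (ℕ.m≤m+n _ (totalV b)))) ⟩
  1ℤ * G x                      ≡⟨ ℤ.*-identityˡ (G x) ⟩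
  G x                           ∎
  where
  open ≡-Reasoning
  T = totalV (x ∷ a) ℕ.+ totalV b
  G : ℕ → ℤ
  G t = ind (isPower? (1 ∷ ma , mb) t (x ∷ a) b)
  only-x : ∀ t → G t ≡ ind (t ℕ.≟ x) * G x
  only-x t with t ℕ.≟ x
  ... | yes refl = sym (ℤ.*-identityˡ (G t))
  ... | no t≢x   = ind-no (isPower? (1 ∷ ma , mb) t (x ∷ a) b) λ (t∷ma≡x∷a , _) →
                     t≢x (trans (sym (ℕ.*-identityʳ t)) (Vec.∷-injectiveˡ t∷ma≡x∷a))

oneMinus-⊛-geom : {n : ℕ} (m : Mono (suc n)) → Vec.head (proj₁ m) ≡ 1 → (oneMinus m ⊛ geom m) ≐ oneS
oneMinus-⊛-geom (.1 ∷ ma , mb) refl (zero ∷ a) b = begin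
  (oneMinus m ⊛ geom m) (0 ∷ a) b
    ≡⟨ oneMinus-⊛ (1 ∷ ma) mb (geom m) (0 ∷ a) b ⟩
  geom m (0 ∷ a) b - ind m≤? * ind mb≤? * geom m ((0 ∷ a) -v (1 ∷ ma)) (b -v mb)
    ≡⟨ cong₂ _-_ (geom-at ma mb 0 a b)
                 (cong (λ z → z * ind mb≤? * geom m ((0 ∷ a) -v (1 ∷ ma)) (b -v mb)) (ind-no m≤? λ { (() ∷ _) })) ⟩
  ind power? - 0ℤ
    ≡⟨ ℤ.+-identityʳ (ind power?) ⟩
  ind power?
    ≡⟨ ind-⇔ power? ((0 ∷ a) ≟v zeroV ×-dec b ≟v zeroV) power-zero ⟩
  oneS (0 ∷ a) b
    ∎
  where
  open ≡-Reasoning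
  m = (1 ∷ ma , mb)
  m≤? = (1 ∷ ma) ≤ᵥ? (0 ∷ a)
  mb≤? = mb ≤ᵥ? b
  power? = isPower? m 0 (0 ∷ a) b
  power-zero : IsPower m 0 (0 ∷ a) b ⇔ ((0 ∷ a) ≡ zeroV × b ≡ zeroV)
  power-zero = mk⇔ (λ (e₁ , e₂) → trans (sym e₁) (scale-zero (1 ∷ ma)) , trans (sym e₂) (scale-zero mb))
                   (λ (e₁ , e₂) → trans (scale-zero (1 ∷ ma)) (sym e₁) , trans (scale-zero mb) (sym e₂))
oneMinus-⊛-geom (.1 ∷ ma , mb) refl (suc t ∷ a) b = begin
  (oneMinus m ⊛ geom m) (suc t ∷ a) b
    ≡⟨ oneMinus-⊛ (1 ∷ ma) mb (geom m) (suc t ∷ a) b ⟩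
  geom m (suc t ∷ a) b - ind m≤? * ind mb≤? * geom m (t ∷ (a -v ma)) (b -v mb)
    ≡⟨ cong₂ (λ u v → u - ind m≤? * ind mb≤? * v) (geom-at ma mb (suc t) a b) (geom-at ma mb t (a -v ma) (b -v mb)) ⟩
  ind power₊? - ind m≤? * ind mb≤? * ind power?
    ≡⟨ cong (ind power₊? -_) quotient-power ⟩
  ind power₊? - ind power₊?
    ≡⟨ ℤ.+-inverseʳ (ind power₊?) ⟩
  0ℤ
    ≡⟨ ind-no ((suc t ∷ a) ≟v zeroV ×-dec b ≟v zeroV) (λ { (() , _) }) ⟨
  oneS (suc t ∷ a) b
    ∎
  where
  open ≡-Reasoning
  m = (1 ∷ ma , mb)
  m≤? = (1 ∷ ma) ≤ᵥ? (suc t ∷ a)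
  mb≤? = mb ≤ᵥ? b
  power? = isPower? m t (t ∷ (a -v ma)) (b -v mb)
  power₊? = isPower? m (suc t) (suc t ∷ a) b
  power-suc : ((1 ∷ ma ≤ᵥ suc t ∷ a × mb ≤ᵥ b) × IsPower m t (t ∷ (a -v ma)) (b -v mb)) ⇔ IsPower m (suc t) (suc t ∷ a) b
  power-suc = mk⇔ (λ ((m≤a , mb≤b) , (e₁ , e₂)) → Equivalence.from (scale-suc t (1 ∷ ma) (suc t ∷ a)) (m≤a , e₁)
                                                , Equivalence.from (scale-suc t mb b) (mb≤b , e₂))
                  (λ (e₁ , e₂) → let (m≤a , e₁′) = Equivalence.to (scale-suc t (1 ∷ ma) (suc t ∷ a)) e₁
                                     (mb≤b , e₂′) = Equivalence.to (scale-suc t mb b) e₂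
                                 in (m≤a , mb≤b) , (e₁′ , e₂′))
  quotient-power : ind m≤? * ind mb≤? * ind power? ≡ ind power₊?
  quotient-power = trans (sym (trans (ind-× (m≤? ×-dec mb≤?) power?) (cong (_* ind power?) (ind-× m≤? mb≤?))))
                         (ind-⇔ ((m≤? ×-dec mb≤?) ×-dec power?) power₊? power-suc)

-- Cylindric partitions as pairs of rows

-- A row a_1, a_2, … of a partition is the function j ↦ a_{j+1}; F and G are always the a- and b-row.
Row : Set
Row = ℕ → ℕ

RowPred : Set₁
RowPred = Row → Row → Set

infix 4 _≤ᵣ_

_≤ᵣ_ : Row → Row → Set
M ≤ᵣ F = ∀ j → M j ≤ F j

_+ᵣ_ _∸ᵣ_ : Row → Row → Row
(F +ᵣ M) j = F j ℕ.+ M j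
(F ∸ᵣ M) j = F j ∸ M j

-- χ k is the exponent row of X_k, and of Y_k.
χ : ℕ → Row
χ k j = if j <ᵇ k then 1 else 0

χ-< : ∀ {k j} → j < k → χ k j ≡ 1
χ-< {suc k} {zero}  _         = refl
χ-< {suc k} {suc j} (s≤s j<k) = χ-< {k} {j} j<k

χ-≥ : ∀ {k j} → k ≤ j → χ k j ≡ 0
χ-≥ {zero}  {j}     _         = refl
χ-≥ {suc k} {suc j} (s≤s k≤j) = χ-≥ {k} {j} k≤j

χ-mono : ∀ {k j k′ j′} → (j′ < k′ → j < k) → χ k′ j′ ≤ χ k j
χ-mono {k} {j} {k′} {j′} j′<k′⇒j<k with j′ ℕ.<? k′
... | yes j′<k′ = ℕ.≤-reflexive (trans (χ-< j′<k′) (sym (χ-< (j′<k′⇒j<k j′<k′))))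
... | no  j′≮k′ = ℕ.≤-trans (ℕ.≤-reflexive (χ-≥ (ℕ.≮⇒≥ j′≮k′))) z≤n

χ-≤ᵣ-last : ∀ {k F} → χ (suc k) ≤ᵣ F → 1 ≤ F k
χ-≤ᵣ-last {k} {F} χ≤F = subst (_≤ F k) (χ-< {suc k} {k} ℕ.≤-refl) (χ≤F k)

χ-≤ᵣ : ∀ k {F} → (∀ j → j < k → 1 ≤ F j) → χ k ≤ᵣ F
χ-≤ᵣ k {F} positive j with j ℕ.<? k
... | yes j<k = subst (_≤ F j) (sym (χ-< j<k)) (positive j j<k)
... | no  j≮k = subst (_≤ F j) (sym (χ-≥ (ℕ.≮⇒≥ j≮k))) z≤n

∸χ-self : ∀ {F} k → (F ∸ᵣ χ k) k ≡ F k
∸χ-self {F} k = cong (F k ∸_) (χ-≥ {k} ℕ.≤-refl)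

CylindricAt : Row → Row → ℕ → Set
CylindricAt F G j = F j ≥ F (suc j) × G j ≥ G (suc j) × F j ≥ G j × G j ≥ F (suc (suc j))

Cylindric : RowPred
Cylindric F G = ∀ j → CylindricAt F G j

-- At most k nonzero entries in the a-row and at most l in the b-row, as the rows decrease.
CP : ℕ → ℕ → RowPred
CP k l F G = Cylindric F G × F k ≡ 0 × G l ≡ 0

-- (F , G) = (M , N) + (F′ , G′) with R F′ G′: x^F y^G is a term of x^M y^N times the series of R.
record Shifted (M N : Row) (R : RowPred) (F G : Row) : Set where
  constructor shifted
  field
    M≤F       : M ≤ᵣ F
    N≤G       : N ≤ᵣ G
    remainder : R (F ∸ᵣ M) (G ∸ᵣ N)

antitone : {f : Row} → (∀ j → f (suc j) ≤ f j) → ∀ {i j} → i ≤ j → f j ≤ f i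
antitone {f} f↓ i≤j = go (ℕ.≤⇒≤′ i≤j)
  where
  go : ∀ {i j} → i ≤′ j → f j ≤ f i
  go ℕ.≤′-refl       = ℕ.≤-refl
  go (ℕ.≤′-step i≤j) = ℕ.≤-trans (f↓ _) (go i≤j)

module _ {F G : Row} (cyl : Cylindric F G) where

  F-antitone : ∀ {i j} → i ≤ j → F j ≤ F i
  F-antitone = antitone (λ j → proj₁ (cyl j))

  G-antitone : ∀ {i j} → i ≤ j → G j ≤ G i
  G-antitone = antitone (λ j → proj₁ (proj₂ (cyl j)))

  F-vanishes : ∀ {k j} → F k ≡ 0 → k ≤ j → F j ≡ 0
  F-vanishes {j = j} Fk≡0 k≤j = ℕ.n≤0⇒n≡0 (subst (F j ≤_) Fk≡0 (F-antitone k≤j))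

  G-vanishes : ∀ {k j} → G k ≡ 0 → k ≤ j → G j ≡ 0
  G-vanishes {j = j} Gk≡0 k≤j = ℕ.n≤0⇒n≡0 (subst (G j ≤_) Gk≡0 (G-antitone k≤j))

  G≤F : ∀ j → G j ≤ F j
  G≤F j = proj₁ (proj₂ (proj₂ (cyl j)))

  F-positive : ∀ {k j} → F k ≢ 0 → j ≤ k → 1 ≤ F j
  F-positive Fk≢0 j≤k = ℕ.≤-trans (ℕ.n≢0⇒n>0 Fk≢0) (F-antitone j≤k)

  G-positive : ∀ {k j} → G k ≢ 0 → j ≤ k → 1 ≤ G j
  G-positive Gk≢0 j≤k = ℕ.≤-trans (ℕ.n≢0⇒n>0 Gk≢0) (G-antitone j≤k)

Extensional : RowPred → Set
Extensional R = ∀ {F F′ G G′} → F ≗ F′ → G ≗ G′ → R F G → R F′ G′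

Cylindric-ext : Extensional Cylindric
Cylindric-ext {F} {F′} {G} {G′} F≗F′ G≗G′ cyl j with cyl j
... | F↓ , G↓ , G≤F , F≤G =
  subst₂ _≤_ (F≗F′ (suc j)) (F≗F′ j) F↓ , subst₂ _≤_ (G≗G′ (suc j)) (G≗G′ j) G↓ ,
  subst₂ _≤_ (G≗G′ j) (F≗F′ j) G≤F , subst₂ _≤_ (F≗F′ (suc (suc j))) (G≗G′ j) F≤G

CP-ext : ∀ k l → Extensional (CP k l)
CP-ext k l F≗F′ G≗G′ (cyl , Fk≡0 , Gl≡0) =
  Cylindric-ext F≗F′ G≗G′ cyl , trans (sym (F≗F′ k)) Fk≡0 , trans (sym (G≗G′ l)) Gl≡0

Shifted-cong : ∀ {M N A B F G} → (A (F ∸ᵣ M) (G ∸ᵣ N) ⇔ B (F ∸ᵣ M) (G ∸ᵣ N)) → Shifted M N A F G ⇔ Shifted M N B F G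
Shifted-cong A⇔B = mk⇔ (λ (shifted M≤F N≤G a) → shifted M≤F N≤G (Equivalence.to A⇔B a))
                       (λ (shifted M≤F N≤G b) → shifted M≤F N≤G (Equivalence.from A⇔B b))

Shifted-+ : ∀ {M₁ M₂ N₁ N₂ R F G} → Extensional R →
            Shifted (M₁ +ᵣ M₂) (N₁ +ᵣ N₂) R F G ⇔ Shifted M₁ N₁ (Shifted M₂ N₂ R) F G
Shifted-+ {M₁} {M₂} {N₁} {N₂} {R} {F} {G} R-ext = mk⇔ to from
  where
  to : Shifted (M₁ +ᵣ M₂) (N₁ +ᵣ N₂) R F G → Shifted M₁ N₁ (Shifted M₂ N₂ R) F G
  to (shifted M≤F N≤G r) = shifted
    (λ j → ℕ.m+n≤o⇒m≤o (M₁ j) (M≤F j)) (λ j → ℕ.m+n≤o⇒m≤o (N₁ j) (N≤G j)) (shifted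
    (λ j → ℕ.m+n≤o⇒m≤o∸n (M₂ j) (subst (_≤ F j) (ℕ.+-comm (M₁ j) (M₂ j)) (M≤F j)))
    (λ j → ℕ.m+n≤o⇒m≤o∸n (N₂ j) (subst (_≤ G j) (ℕ.+-comm (N₁ j) (N₂ j)) (N≤G j)))
    (R-ext (λ j → sym (ℕ.∸-+-assoc (F j) (M₁ j) (M₂ j))) (λ j → sym (ℕ.∸-+-assoc (G j) (N₁ j) (N₂ j))) r))
  from : Shifted M₁ N₁ (Shifted M₂ N₂ R) F G → Shifted (M₁ +ᵣ M₂) (N₁ +ᵣ N₂) R F G
  from (shifted M₁≤F N₁≤G (shifted M₂≤F∸M₁ N₂≤G∸N₁ r)) = shifted
    (λ j → subst (_≤ F j) (ℕ.+-comm (M₂ j) (M₁ j)) (ℕ.m≤o∸n⇒m+n≤o (M₂ j) (M₁≤F j) (M₂≤F∸M₁ j)))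
    (λ j → subst (_≤ G j) (ℕ.+-comm (N₂ j) (N₁ j)) (ℕ.m≤o∸n⇒m+n≤o (N₂ j) (N₁≤G j) (N₂≤G∸N₁ j)))
    (R-ext (λ j → ℕ.∸-+-assoc (F j) (M₁ j) (M₂ j)) (λ j → ℕ.∸-+-assoc (G j) (N₁ j) (N₂ j)) r)

+χ-≤ : ∀ {x′ x k′ j′ k j} → χ k′ j′ ≤ x′ → χ k j ≤ x → x′ ∸ χ k′ j′ ≤ x ∸ χ k j → (j′ < k′ → j < k) → x′ ≤ x
+χ-≤ {x′} {x} {k′} {j′} {k} {j} χ′≤x′ χ≤x x′∸χ′≤x∸χ j′<k′⇒j<k = begin
  x′                        ≡⟨ ℕ.m∸n+n≡m χ′≤x′ ⟨
  x′ ∸ χ k′ j′ ℕ.+ χ k′ j′  ≤⟨ ℕ.+-mono-≤ x′∸χ′≤x∸χ (χ-mono j′<k′⇒j<k) ⟩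
  x ∸ χ k j ℕ.+ χ k j       ≡⟨ ℕ.m∸n+n≡m χ≤x ⟩
  x                         ∎
  where open ℕ.≤-Reasoning

∸χ-≤ : ∀ {x′ x k′ j′ k j} → x′ ≤ x → (k′ ≤ j′ → x′ ≡ 0) → (j′ < k′ → j < k) → x′ ∸ χ k′ j′ ≤ x ∸ χ k j
∸χ-≤ {x′} {x} {k′} {j′} {k} {j} x′≤x x′-vanishes j′<k′⇒j<k with j′ ℕ.<? k′
... | yes j′<k′ = subst₂ (λ u v → x′ ∸ u ≤ x ∸ v) (sym (χ-< j′<k′)) (sym (χ-< (j′<k′⇒j<k j′<k′))) (ℕ.∸-monoˡ-≤ 1 x′≤x)
... | no  j′≮k′ = subst (λ u → u ∸ χ k′ j′ ≤ x ∸ χ k j) (sym (x′-vanishes (ℕ.≮⇒≥ j′≮k′)))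
                         (subst (_≤ x ∸ χ k j) (sym (ℕ.0∸n≡0 (χ k′ j′))) z≤n)

-- Multiplication by X_k Y_l respects the inequalities of profile (2,0) because l ≤ k ≤ l + 2.
module _ {k l : ℕ} (l≤k : l ≤ k) (k≤2+l : k ≤ 2 ℕ.+ l) where

  private
    F↓-index : ∀ j → suc j < k → j < k
    F↓-index j = ℕ.<-trans (ℕ.n<1+n j)

    G↓-index : ∀ j → suc j < l → j < l
    G↓-index j = ℕ.<-trans (ℕ.n<1+n j)

    G≤F-index : ∀ j → j < l → j < k
    G≤F-index j j<l = ℕ.<-≤-trans j<l l≤k

    F≤G-index : ∀ j → 2 ℕ.+ j < k → j < l
    F≤G-index j 2+j<k = ℕ.+-cancelˡ-< 2 j l (ℕ.<-≤-trans 2+j<k k≤2+l)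

  cylindric-from-∸χ : ∀ {F G} → χ k ≤ᵣ F → χ l ≤ᵣ G → Cylindric (F ∸ᵣ χ k) (G ∸ᵣ χ l) → Cylindric F G
  cylindric-from-∸χ χ≤F χ≤G cyl j with cyl j
  ... | F↓ , G↓ , G≤F , F≤G =
    +χ-≤ (χ≤F (suc j)) (χ≤F j) F↓ (F↓-index j) , +χ-≤ (χ≤G (suc j)) (χ≤G j) G↓ (G↓-index j) ,
    +χ-≤ (χ≤G j) (χ≤F j) G≤F (G≤F-index j) , +χ-≤ (χ≤F (2 ℕ.+ j)) (χ≤G j) F≤G (F≤G-index j)

  cylindric-∸χ : ∀ {F G} → F k ≡ 0 → G l ≡ 0 → Cylindric F G → Cylindric (F ∸ᵣ χ k) (G ∸ᵣ χ l)
  cylindric-∸χ Fk≡0 Gl≡0 cyl j with cyl j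
  ... | F↓ , G↓ , G≤F , F≤G =
    ∸χ-≤ F↓ (F-vanishes cyl Fk≡0) (F↓-index j) , ∸χ-≤ G↓ (G-vanishes cyl Gl≡0) (G↓-index j) ,
    ∸χ-≤ G≤F (G-vanishes cyl Gl≡0) (G≤F-index j) , ∸χ-≤ F≤G (F-vanishes cyl Fk≡0) (F≤G-index j)

  Shifted-CP : ∀ {F G} → Shifted (χ k) (χ l) (CP k l) F G ⇔ (χ k ≤ᵣ F × χ l ≤ᵣ G × CP k l F G)
  Shifted-CP {F} {G} = mk⇔ to from
    where
    χkk≡0 : χ k k ≡ 0
    χkk≡0 = χ-≥ {k} ℕ.≤-refl
    χll≡0 : χ l l ≡ 0
    χll≡0 = χ-≥ {l} ℕ.≤-refl
    to : Shifted (χ k) (χ l) (CP k l) F G → χ k ≤ᵣ F × χ l ≤ᵣ G × CP k l F G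
    to (shifted χ≤F χ≤G (cyl , F′k≡0 , G′l≡0)) =
      χ≤F , χ≤G , cylindric-from-∸χ χ≤F χ≤G cyl ,
      trans (sym (cong (F k ∸_) χkk≡0)) F′k≡0 , trans (sym (cong (G l ∸_) χll≡0)) G′l≡0
    from : χ k ≤ᵣ F × χ l ≤ᵣ G × CP k l F G → Shifted (χ k) (χ l) (CP k l) F G
    from (χ≤F , χ≤G , cyl , Fk≡0 , Gl≡0) =
      shifted χ≤F χ≤G (cylindric-∸χ Fk≡0 Gl≡0 cyl ,
                       trans (cong (_∸ χ k k) Fk≡0) (ℕ.0∸n≡0 (χ k k)) , trans (cong (_∸ χ l l) Gl≡0) (ℕ.0∸n≡0 (χ l l)))

-- The members of CP k l that are not X_k Y_l times a member of CP k l (for 1 ≤ k, see CP-split).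
Irreducible : ℕ → ℕ → RowPred
Irreducible k l F G = CP k l F G × (F (k ∸ 1) ≡ 0 ⊎ (1 ≤ l × G (l ∸ 1) ≡ 0))

Irreducible-ext : ∀ k l → Extensional (Irreducible k l)
Irreducible-ext k l F≗F′ G≗G′ (cp , inj₁ F≡0)       = CP-ext k l F≗F′ G≗G′ cp , inj₁ (trans (sym (F≗F′ (k ∸ 1))) F≡0)
Irreducible-ext k l F≗F′ G≗G′ (cp , inj₂ (1≤l , G≡0)) = CP-ext k l F≗F′ G≗G′ cp , inj₂ (1≤l , trans (sym (G≗G′ (l ∸ 1))) G≡0)

χ-≤ᵣ-G : ∀ {l F G} → Cylindric F G → ¬ (1 ≤ l × G (l ∸ 1) ≡ 0) → χ l ≤ᵣ G
χ-≤ᵣ-G {zero}  cyl _   = χ-≤ᵣ 0 λ _ ()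
χ-≤ᵣ-G {suc l} cyl ¬p = χ-≤ᵣ (suc l) λ { j (s≤s j≤l) → G-positive cyl (λ G≡0 → ¬p (s≤s z≤n , G≡0)) j≤l }

¬Shifted-F : ∀ {k N R F G} → F k ≡ 0 → ¬ Shifted (χ (suc k)) N R F G
¬Shifted-F Fk≡0 (shifted χ≤F _ _) = ℕ.<-irrefl (sym Fk≡0) (χ-≤ᵣ-last χ≤F)

¬Shifted-G : ∀ {l M R F G} → G l ≡ 0 → ¬ Shifted M (χ (suc l)) R F G
¬Shifted-G Gl≡0 (shifted _ χ≤G _) = ℕ.<-irrefl (sym Gl≡0) (χ-≤ᵣ-last χ≤G)

Irreducible⇒¬Shifted : ∀ {k l R F G} → Irreducible (suc k) l F G → ¬ Shifted (χ (suc k)) (χ l) R F G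
Irreducible⇒¬Shifted (_ , inj₁ Fk≡0)            = ¬Shifted-F Fk≡0
Irreducible⇒¬Shifted (_ , inj₂ (s≤s z≤n , G≡0)) = ¬Shifted-G G≡0

CP-split : ∀ {k l F G} → l ≤ suc k → suc k ≤ 2 ℕ.+ l →
           CP (suc k) l F G ⇔ (Irreducible (suc k) l F G ⊎ Shifted (χ (suc k)) (χ l) (CP (suc k) l) F G)
CP-split {k} {l} {F} {G} l≤k k≤2+l = mk⇔ to from
  where
  to : CP (suc k) l F G → Irreducible (suc k) l F G ⊎ Shifted (χ (suc k)) (χ l) (CP (suc k) l) F G
  to cp@(cyl , _) with F k ℕ.≟ 0 | (1 ℕ.≤? l) ×-dec (G (l ∸ 1) ℕ.≟ 0)
  ... | yes Fk≡0 | _      = inj₁ (cp , inj₁ Fk≡0)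
  ... | no  _    | yes p  = inj₁ (cp , inj₂ p)
  ... | no  Fk≢0 | no  ¬p = inj₂ (Equivalence.from (Shifted-CP l≤k k≤2+l)
                                   (χ-≤ᵣ (suc k) (λ { j (s≤s j≤k) → F-positive cyl Fk≢0 j≤k }) , χ-≤ᵣ-G cyl ¬p , cp))
  from : Irreducible (suc k) l F G ⊎ Shifted (χ (suc k)) (χ l) (CP (suc k) l) F G → CP (suc k) l F G
  from (inj₁ (cp , _)) = cp
  from (inj₂ sh)       = proj₂ (proj₂ (Equivalence.to (Shifted-CP l≤k k≤2+l) sh))

Irreducible-diagonal : ∀ {c F G} → Irreducible (suc c) (suc c) F G ⇔ CP (suc c) c F G
Irreducible-diagonal {c} {F} {G} = mk⇔ to from
  where
  to : Irreducible (suc c) (suc c) F G → CP (suc c) c F G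
  to ((cyl , F≡0 , _) , inj₁ Fc≡0)      = cyl , F≡0 , ℕ.n≤0⇒n≡0 (subst (G c ≤_) Fc≡0 (G≤F cyl c))
  to ((cyl , F≡0 , _) , inj₂ (_ , Gc≡0)) = cyl , F≡0 , Gc≡0
  from : CP (suc c) c F G → Irreducible (suc c) (suc c) F G
  from (cyl , F≡0 , Gc≡0) = (cyl , F≡0 , G-vanishes cyl Gc≡0 (ℕ.n≤1+n c)) , inj₂ (s≤s z≤n , Gc≡0)

Irreducible-F≡0 : ∀ {c F G} → F c ≡ 0 → Irreducible (suc c) c F G ⇔ CP c c F G
Irreducible-F≡0 {c} Fc≡0 = mk⇔ (λ ((cyl , _ , Gc≡0) , _) → cyl , Fc≡0 , Gc≡0)
                               (λ (cyl , _ , Gc≡0) → (cyl , F-vanishes cyl Fc≡0 (ℕ.n≤1+n c) , Gc≡0) , inj₁ Fc≡0)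

Irreducible-G≡0 : ∀ {c F G} → G c ≡ 0 → Irreducible (2 ℕ.+ c) (suc c) F G ⇔ CP (2 ℕ.+ c) c F G
Irreducible-G≡0 {c} Gc≡0 = mk⇔ (λ ((cyl , F≡0 , _) , _) → cyl , F≡0 , Gc≡0)
                               (λ (cyl , F≡0 , _) → (cyl , F≡0 , G-vanishes cyl Gc≡0 (ℕ.n≤1+n c)) , inj₂ (s≤s z≤n , Gc≡0))

Irreducible-shifted : ∀ {c F G} → ¬ (1 ≤ c × G (c ∸ 1) ≡ 0) →
                      Irreducible (suc c) c F G ⇔ Shifted (χ c) (χ c) (CP c c) F G
Irreducible-shifted {c} {F} {G} ¬p = mk⇔ to from
  where
  to : Irreducible (suc c) c F G → Shifted (χ c) (χ c) (CP c c) F G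
  to (_ , inj₂ p) = ⊥-elim (¬p p)
  to ((cyl , _ , Gc≡0) , inj₁ Fc≡0) = Equivalence.from (Shifted-CP ℕ.≤-refl (ℕ.m≤n+m c 2))
    ((λ j → ℕ.≤-trans (χ≤G j) (G≤F cyl j)) , χ≤G , cyl , Fc≡0 , Gc≡0)
    where χ≤G = χ-≤ᵣ-G cyl ¬p
  from : Shifted (χ c) (χ c) (CP c c) F G → Irreducible (suc c) c F G
  from sh with Equivalence.to (Shifted-CP ℕ.≤-refl (ℕ.m≤n+m c 2)) sh
  ... | _ , _ , cp@(_ , Fc≡0 , _) = Equivalence.from (Irreducible-F≡0 Fc≡0) cp

Irreducible-self-shifted : ∀ {c F G} → F (suc c) ≢ 0 → G c ≡ 0 →
  Irreducible (2 ℕ.+ c) (suc c) F G ⇔ Shifted (χ (2 ℕ.+ c)) (χ c) (Irreducible (2 ℕ.+ c) (suc c)) F G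
Irreducible-self-shifted {c} {F} {G} F≢0 Gc≡0 =
  ⇔-trans (Irreducible-G≡0 Gc≡0) (⇔-trans CP⇔shifted (Shifted-cong (⇔-sym (Irreducible-G≡0 (trans (∸χ-self {G} c) Gc≡0)))))
  where
  CP⇔shifted : CP (2 ℕ.+ c) c F G ⇔ Shifted (χ (2 ℕ.+ c)) (χ c) (CP (2 ℕ.+ c) c) F G
  CP⇔shifted = mk⇔
    (λ cp@(cyl , _) → Equivalence.from (Shifted-CP (ℕ.m≤n+m c 2) ℕ.≤-refl)
       ( χ-≤ᵣ (2 ℕ.+ c) (λ { j (s≤s j≤1+c) → F-positive cyl F≢0 j≤1+c })
       , χ-≤ᵣ c (λ j j<c → ℕ.≤-trans (F-positive cyl F≢0 (s≤s j<c)) (proj₂ (proj₂ (proj₂ (cyl j)))))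
       , cp))
    (proj₂ ∘ proj₂ ∘ Equivalence.to (Shifted-CP (ℕ.m≤n+m c 2) ℕ.≤-refl))

Shifted-numerator : ∀ {c F G} → Shifted (χ (suc c) +ᵣ χ c) (χ (c ∸ 1) +ᵣ χ c) (CP c c) F G
                       ⇔ Shifted (χ (suc c)) (χ (c ∸ 1)) (Shifted (χ c) (χ c) (CP c c)) F G
Shifted-numerator {c} = Shifted-+ {χ (suc c)} {χ c} {χ (c ∸ 1)} {χ c} (CP-ext c c)

Shifted-Irreducible⇔Shifted-numerator : ∀ {c F G} → ¬ (1 ≤ c × G (c ∸ 1) ≡ 0) →
  Shifted (χ (suc c)) (χ (c ∸ 1)) (Irreducible (suc c) c) F G ⇔ Shifted (χ (suc c) +ᵣ χ c) (χ (c ∸ 1) +ᵣ χ c) (CP c c) F G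
Shifted-Irreducible⇔Shifted-numerator {c} {F} {G} ¬p = ⇔-trans (Shifted-cong (Irreducible-shifted ¬p′)) (⇔-sym Shifted-numerator)
  where ¬p′ = λ (1≤c , G′≡0) → ¬p (1≤c , trans (sym (∸χ-self {G} (c ∸ 1))) G′≡0)

-- The coefficient of x^F y^G in (1 - X_{c+1}Y_{c-1}) Irreducible_{c+1,c} = (1 - X_c X_{c+1} Y_{c-1} Y_c) CP_{c,c}.
LastFactorIdentity : ℕ → Row → Row → Set
LastFactorIdentity c F G =
  (dI  : Dec (Irreducible (suc c) c F G)) (dSI : Dec (Shifted (χ (suc c)) (χ (c ∸ 1)) (Irreducible (suc c) c) F G))
  (dP  : Dec (CP c c F G))                (dSP : Dec (Shifted (χ (suc c) +ᵣ χ c) (χ (c ∸ 1) +ᵣ χ c) (CP c c) F G)) →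
  ind dI - ind dSI ≡ ind dP - ind dSP

last-factor-F≡0 : ∀ c {F G} → F c ≡ 0 → LastFactorIdentity c F G
last-factor-F≡0 c Fc≡0 dI dSI dP dSP = cong₂ _-_
  (ind-⇔ dI dP (Irreducible-F≡0 Fc≡0))
  (trans (ind-no dSI (¬Shifted-F Fc≡0)) (sym (ind-no dSP (¬Shifted-F Fc≡0 ∘ Equivalence.to Shifted-numerator))))

last-factor-G≡0 : ∀ c {F G} → F (suc c) ≢ 0 → G c ≡ 0 → LastFactorIdentity (suc c) F G
last-factor-G≡0 c {F} {G} F≢0 Gc≡0 dI dSI dP dSP = begin
  ind dI - ind dSI   ≡⟨ cong (_- ind dSI) (ind-⇔ dI dSI (Irreducible-self-shifted F≢0 Gc≡0)) ⟩
  ind dSI - ind dSI  ≡⟨ ℤ.+-inverseʳ (ind dSI) ⟩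
  0ℤ                 ≡⟨ sym (cong₂ _-_ (ind-no dP λ (_ , F≡0 , _) → F≢0 F≡0) (ind-no dSP ¬shifted)) ⟩
  ind dP - ind dSP   ∎
  where
  open ≡-Reasoning
  ¬shifted = λ sh → ¬Shifted-G (trans (∸χ-self {G} c) Gc≡0) (Shifted.remainder (Equivalence.to Shifted-numerator sh))

last-factor-positive : ∀ c {F G} → F c ≢ 0 → ¬ (1 ≤ c × G (c ∸ 1) ≡ 0) → LastFactorIdentity c F G
last-factor-positive c F≢0 ¬p dI dSI dP dSP = cong₂ _-_
  (trans (ind-no dI ¬irreducible) (sym (ind-no dP λ (_ , F≡0 , _) → F≢0 F≡0)))
  (ind-⇔ dSI dSP (Shifted-Irreducible⇔Shifted-numerator ¬p))
  where
  ¬irreducible = λ { (_ , inj₁ F≡0) → F≢0 F≡0 ; (_ , inj₂ p) → ¬p p }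

last-factor : ∀ c {F G} → LastFactorIdentity c F G
last-factor zero    {F}     with F 0 ℕ.≟ 0
... | yes F≡0 = last-factor-F≡0 0 F≡0
... | no  F≢0 = last-factor-positive 0 F≢0 λ ()
last-factor (suc c) {F} {G} with F (suc c) ℕ.≟ 0 | G c ℕ.≟ 0
... | yes F≡0 | _       = last-factor-F≡0 (suc c) F≡0
... | no  F≢0 | yes G≡0 = last-factor-G≡0 c F≢0 G≡0
... | no  F≢0 | no  G≢0 = last-factor-positive (suc c) F≢0 λ (_ , G≡0) → G≢0 G≡0

-- Rows of coefficient vectors

ext-beyond : {n : ℕ} (a : Vec ℕ n) {j : ℕ} → n ≤ j → ext a j ≡ 0
ext-beyond []      _         = refl
ext-beyond (x ∷ a) (s≤s n≤j) = ext-beyond a n≤j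

ext-zipWith : {n : ℕ} (_∙_ : ℕ → ℕ → ℕ) → 0 ∙ 0 ≡ 0 → (u v : Vec ℕ n) (j : ℕ) →
              ext (Vec.zipWith _∙_ u v) j ≡ ext u j ∙ ext v j
ext-zipWith _∙_ 0∙0≡0 []      []      j       = sym 0∙0≡0
ext-zipWith _∙_ 0∙0≡0 (x ∷ u) (y ∷ v) zero    = refl
ext-zipWith _∙_ 0∙0≡0 (x ∷ u) (y ∷ v) (suc j) = ext-zipWith _∙_ 0∙0≡0 u v j

ext-+v : {n : ℕ} (u v : Vec ℕ n) → ext (u +v v) ≗ ext u +ᵣ ext v
ext-+v = ext-zipWith ℕ._+_ refl

ext--v : {n : ℕ} (u v : Vec ℕ n) → ext (u -v v) ≗ ext u ∸ᵣ ext v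
ext--v = ext-zipWith _∸_ refl

ext-zeroV : (n j : ℕ) → ext (zeroV {n}) j ≡ 0
ext-zeroV zero    j       = refl
ext-zeroV (suc n) zero    = refl
ext-zeroV (suc n) (suc j) = ext-zeroV n j

ext-zero⇒zeroV : {n : ℕ} (a : Vec ℕ n) → (∀ j → ext a j ≡ 0) → a ≡ zeroV
ext-zero⇒zeroV []      _      = refl
ext-zero⇒zeroV (x ∷ a) a≗0 = cong₂ _∷_ (a≗0 0) (ext-zero⇒zeroV a (a≗0 ∘ suc))

ext-prefix : {n k : ℕ} → k ≤ n → ext (prefix {n} k) ≗ χ k
ext-prefix {n} {k} k≤n j with j ℕ.<? n
... | yes j<n = ext-tabulate n (χ k) j j<n
  where
  ext-tabulate : ∀ n (f : Row) j → j < n → ext (tabulate {n = n} (f ∘ toℕ)) j ≡ f j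
  ext-tabulate (suc n) f zero    _         = refl
  ext-tabulate (suc n) f (suc j) (s≤s j<n) = ext-tabulate n (f ∘ suc) j j<n
... | no  j≮n = trans (ext-beyond (prefix k) (ℕ.≮⇒≥ j≮n)) (sym (χ-≥ (ℕ.≤-trans k≤n (ℕ.≮⇒≥ j≮n))))

≤ᵥ⇔≤ᵣ : {n : ℕ} (u v : Vec ℕ n) → u ≤ᵥ v ⇔ ext u ≤ᵣ ext v
≤ᵥ⇔≤ᵣ u v = mk⇔ (to u v) (from u v)
  where
  to : ∀ {n} (u v : Vec ℕ n) → u ≤ᵥ v → ext u ≤ᵣ ext v
  to []      []      []          j       = z≤n
  to (x ∷ u) (y ∷ v) (x≤y ∷ u≤v) zero    = x≤y
  to (x ∷ u) (y ∷ v) (x≤y ∷ u≤v) (suc j) = to u v u≤v j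
  from : ∀ {n} (u v : Vec ℕ n) → ext u ≤ᵣ ext v → u ≤ᵥ v
  from []      []      _   = []
  from (x ∷ u) (y ∷ v) u≤v = u≤v 0 ∷ from u v (u≤v ∘ suc)

record Decider (n : ℕ) (R : RowPred) : Set where
  constructor decider
  field decide : (a b : Vec ℕ n) → Dec (R (ext a) (ext b))

open Decider

𝟙 : {n : ℕ} {R : RowPred} → Decider n R → Series n
𝟙 R? a b = ind (decide R? a b)

-- m is x^M y^N with the exponent rows cut down to n variables.
record Realises {n : ℕ} (m : Mono n) (M N : Row) : Set where
  field
    ext₁ : ext (proj₁ m) ≗ M
    ext₂ : ext (proj₂ m) ≗ N

module _ {n : ℕ} {m : Mono n} {M N : Row} (m≈MN : Realises m M N) {R : RowPred} (R-ext : Extensional R) where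

  open Realises m≈MN

  divides⇔Shifted : ∀ a b → ((proj₁ m ≤ᵥ a × proj₂ m ≤ᵥ b) × R (ext (a -v proj₁ m)) (ext (b -v proj₂ m)))
                      ⇔ Shifted M N R (ext a) (ext b)
  divides⇔Shifted a b = mk⇔
    (λ ((ma≤a , mb≤b) , r) → shifted (M≤ a ma≤a) (N≤ b mb≤b) (R-ext (ext-∸ a (proj₁ m) ext₁) (ext-∸ b (proj₂ m) ext₂) r))
    (λ (shifted M≤a N≤b r) → (≤M a M≤a , ≤N b N≤b) , R-ext (sym ∘ ext-∸ a (proj₁ m) ext₁) (sym ∘ ext-∸ b (proj₂ m) ext₂) r)
    where
    ext-∸ : ∀ u v {V} → ext v ≗ V → ext (u -v v) ≗ ext u ∸ᵣ V
    ext-∸ u v v≗V j = trans (ext--v u v j) (cong (ext u j ∸_) (v≗V j))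
    M≤ : ∀ a → proj₁ m ≤ᵥ a → M ≤ᵣ ext a
    M≤ a ma≤a j = subst (_≤ ext a j) (ext₁ j) (Equivalence.to (≤ᵥ⇔≤ᵣ (proj₁ m) a) ma≤a j)
    N≤ : ∀ b → proj₂ m ≤ᵥ b → N ≤ᵣ ext b
    N≤ b mb≤b j = subst (_≤ ext b j) (ext₂ j) (Equivalence.to (≤ᵥ⇔≤ᵣ (proj₂ m) b) mb≤b j)
    ≤M : ∀ a → M ≤ᵣ ext a → proj₁ m ≤ᵥ a
    ≤M a M≤a = Equivalence.from (≤ᵥ⇔≤ᵣ (proj₁ m) a) λ j → subst (_≤ ext a j) (sym (ext₁ j)) (M≤a j)
    ≤N : ∀ b → N ≤ᵣ ext b → proj₂ m ≤ᵥ b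
    ≤N b N≤b = Equivalence.from (≤ᵥ⇔≤ᵣ (proj₂ m) b) λ j → subst (_≤ ext b j) (sym (ext₂ j)) (N≤b j)

  shifted? : Decider n R → Decider n (Shifted M N R)
  decide (shifted? R?) a b =
    Dec.map (divides⇔Shifted a b) (((proj₁ m ≤ᵥ? a) ×-dec (proj₂ m ≤ᵥ? b)) ×-dec decide R? (a -v proj₁ m) (b -v proj₂ m))

  oneMinus-⊛-𝟙 : (R? : Decider n R) (a b : Vec ℕ n) → (oneMinus m ⊛ 𝟙 R?) a b ≡ 𝟙 R? a b - 𝟙 (shifted? R?) a b
  oneMinus-⊛-𝟙 R? a b = begin
    (oneMinus m ⊛ 𝟙 R?) a b
      ≡⟨ oneMinus-⊛ (proj₁ m) (proj₂ m) (𝟙 R?) a b ⟩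
    𝟙 R? a b - ind ma≤? * ind mb≤? * ind r?
      ≡⟨ cong (𝟙 R? a b -_) (sym (trans (ind-× (ma≤? ×-dec mb≤?) r?) (cong (_* ind r?) (ind-× ma≤? mb≤?)))) ⟩
    𝟙 R? a b - ind ((ma≤? ×-dec mb≤?) ×-dec r?)
      ≡⟨ cong (𝟙 R? a b -_) (ind-⇔ ((ma≤? ×-dec mb≤?) ×-dec r?) (decide (shifted? R?) a b) (divides⇔Shifted a b)) ⟩
    𝟙 R? a b - 𝟙 (shifted? R?) a b
      ∎
    where
    open ≡-Reasoning
    ma≤? = proj₁ m ≤ᵥ? a
    mb≤? = proj₂ m ≤ᵥ? b
    r? = decide R? (a -v proj₁ m) (b -v proj₂ m)

  oneMinus-⊛-split : {R′ : RowPred} (R? : Decider n R) (R′? : Decider n R′) →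
                     (∀ {F G} → R F G ⇔ (R′ F G ⊎ Shifted M N R F G)) → (∀ {F G} → R′ F G → ¬ Shifted M N R F G) →
                     (oneMinus m ⊛ 𝟙 R?) ≐ 𝟙 R′?
  oneMinus-⊛-split R? R′? split disjoint a b = begin
    (oneMinus m ⊛ 𝟙 R?) a b
      ≡⟨ oneMinus-⊛-𝟙 R? a b ⟩
    𝟙 R? a b - 𝟙 (shifted? R?) a b
      ≡⟨ cong (_- 𝟙 (shifted? R?) a b) (ind-⊎ (decide R? a b) (decide R′? a b) (decide (shifted? R?) a b) split disjoint) ⟩
    𝟙 R′? a b + 𝟙 (shifted? R?) a b - 𝟙 (shifted? R?) a b
      ≡⟨ cancel (𝟙 R′? a b) (𝟙 (shifted? R?) a b) ⟩
    𝟙 R′? a b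
      ∎
    where
    open ≡-Reasoning
    cancel : ∀ x y → x + y - y ≡ x
    cancel = solve-∀

cylindricAt-beyond : {n : ℕ} (a b : Vec ℕ n) {j : ℕ} → n ≤ j → CylindricAt (ext a) (ext b) j
cylindricAt-beyond a b {j} n≤j
  rewrite ext-beyond a n≤j | ext-beyond b n≤j | ext-beyond a (ℕ.m≤n⇒m≤1+n n≤j) | ext-beyond b (ℕ.m≤n⇒m≤1+n n≤j)
        | ext-beyond a (ℕ.m≤n⇒m≤1+n (ℕ.m≤n⇒m≤1+n n≤j))
  = z≤n , z≤n , z≤n , z≤n

Valid⇔Cylindric : {n : ℕ} (a b : Vec ℕ n) → Valid a b ⇔ Cylindric (ext a) (ext b)
Valid⇔Cylindric {n} a b = mk⇔ to (λ cyl j → cyl (toℕ j))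
  where
  to : Valid a b → Cylindric (ext a) (ext b)
  to valid j with j ℕ.<? n
  ... | yes j<n = subst (CylindricAt (ext a) (ext b)) (toℕ-fromℕ< j<n) (valid (fromℕ< j<n))
  ... | no  j≮n = cylindricAt-beyond a b (ℕ.≮⇒≥ j≮n)

CP? : {n : ℕ} (k l : ℕ) → Decider n (CP k l)
decide (CP? k l) a b = Dec.map′ (λ (valid , zeros) → Equivalence.to (Valid⇔Cylindric a b) valid , zeros)
                                (λ (cyl , zeros) → Equivalence.from (Valid⇔Cylindric a b) cyl , zeros)
                                (all? (validAt? a b) ×-dec (ext a k ℕ.≟ 0 ×-dec ext b l ℕ.≟ 0))

Irreducible? : {n : ℕ} (k l : ℕ) → Decider n (Irreducible k l)
decide (Irreducible? k l) a b =
  decide (CP? k l) a b ×-dec (ext a (k ∸ 1) ℕ.≟ 0 ⊎-dec (1 ℕ.≤? l ×-dec ext b (l ∸ 1) ℕ.≟ 0))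

CP20≐𝟙CP : (n : ℕ) → CP20 n ≐ 𝟙 (CP? n n)
CP20≐𝟙CP n a b = ind-⇔ (all? (validAt? a b)) (decide (CP? n n) a b)
  (mk⇔ (λ valid → Equivalence.to (Valid⇔Cylindric a b) valid , ext-beyond a ℕ.≤-refl , ext-beyond b ℕ.≤-refl)
       (λ (cyl , _) → Equivalence.from (Valid⇔Cylindric a b) cyl))

oneS≐𝟙CP : (n : ℕ) → oneS {n} ≐ 𝟙 (CP? 0 0)
oneS≐𝟙CP n a b = ind-⇔ (a ≟v zeroV ×-dec b ≟v zeroV) (decide (CP? 0 0) a b) (mk⇔ to from)
  where
  to : a ≡ zeroV × b ≡ zeroV → CP 0 0 (ext a) (ext b)
  to (refl , refl) = Cylindric-ext (sym ∘ ext-zeroV n) (sym ∘ ext-zeroV n) (λ _ → z≤n , z≤n , z≤n , z≤n) ,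
                     ext-zeroV n 0 , ext-zeroV n 0
  from : CP 0 0 (ext a) (ext b) → a ≡ zeroV × b ≡ zeroV
  from (cyl , F0≡0 , G0≡0) = ext-zero⇒zeroV a (λ j → F-vanishes cyl F0≡0 z≤n) , ext-zero⇒zeroV b (λ j → G-vanishes cyl G0≡0 z≤n)

0ᵣ : Row
0ᵣ _ = 0

Realises-cong : ∀ {n} {m : Mono n} {M M′ N N′} → M ≗ M′ → N ≗ N′ → Realises m M N → Realises m M′ N′
Realises-cong M≗M′ N≗N′ m≈MN = record { ext₁ = λ j → trans (ext₁ j) (M≗M′ j) ; ext₂ = λ j → trans (ext₂ j) (N≗N′ j) }
  where open Realises m≈MN

·-realises : ∀ {n} {m m′ : Mono n} {M M′ N N′} → Realises m M N → Realises m′ M′ N′ → Realises (m · m′) (M +ᵣ M′) (N +ᵣ N′)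
·-realises {m = ma , mb} {ma′ , mb′} m≈MN m′≈MN′ = record
  { ext₁ = λ j → trans (ext-+v ma ma′ j) (cong₂ ℕ._+_ (R.ext₁ j) (R′.ext₁ j))
  ; ext₂ = λ j → trans (ext-+v mb mb′ j) (cong₂ ℕ._+_ (R.ext₂ j) (R′.ext₂ j))
  }
  where
  module R  = Realises m≈MN
  module R′ = Realises m′≈MN′

Xm-realises : ∀ {n k} → k ≤ n → Realises (Xm {n} k) (χ k) 0ᵣ
Xm-realises {n} k≤n = record { ext₁ = ext-prefix k≤n ; ext₂ = ext-zeroV n }

Ym-realises : ∀ {n l} → l ≤ n → Realises (Ym {n} l) 0ᵣ (χ l)
Ym-realises {n} l≤n = record { ext₁ = ext-zeroV n ; ext₂ = ext-prefix l≤n }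

XY-realises : ∀ {n k l} → k ≤ n → l ≤ n → Realises (Xm {n} k · Ym l) (χ k) (χ l)
XY-realises {k = k} k≤n l≤n = Realises-cong (λ j → ℕ.+-identityʳ (χ k j)) (λ _ → refl) (·-realises (Xm-realises k≤n) (Ym-realises l≤n))

numerator : {n : ℕ} → ℕ → Mono n
numerator c = Xm c · (Xm (suc c) · (Ym (c ∸ 1) · Ym c))

numerator-realises : ∀ {n c} → suc c ≤ n → Realises (numerator {n} c) (χ (suc c) +ᵣ χ c) (χ (c ∸ 1) +ᵣ χ c)
numerator-realises {c = c} c<n = Realises-cong reorder (λ _ → refl)
  (·-realises (Xm-realises c≤n) (·-realises (Xm-realises c<n) (·-realises (Ym-realises (ℕ.≤-trans (ℕ.m∸n≤m c 1) c≤n)) (Ym-realises c≤n))))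
  where
  c≤n = ℕ.≤-trans (ℕ.n≤1+n c) c<n
  reorder : ∀ j → χ c j ℕ.+ (χ (suc c) j ℕ.+ (0 ℕ.+ 0)) ≡ χ (suc c) j ℕ.+ χ c j
  reorder j = trans (cong (χ c j ℕ.+_) (ℕ.+-identityʳ (χ (suc c) j))) (ℕ.+-comm (χ c j) (χ (suc c) j))

-- The product formula

module _ {n c : ℕ} (c<n : suc c ≤ n) where

  private
    c≤n : c ≤ n
    c≤n = ℕ.≤-trans (ℕ.n≤1+n c) c<n

  [1-Xc+1Yc+1]-⊛-𝟙CP : (oneMinus (Xm (suc c) · Ym (suc c)) ⊛ 𝟙 (CP? (suc c) (suc c))) ≐ 𝟙 (CP? (suc c) c)
  [1-Xc+1Yc+1]-⊛-𝟙CP = oneMinus-⊛-split (XY-realises c<n c<n) (CP-ext (suc c) (suc c)) (CP? (suc c) (suc c)) (CP? (suc c) c)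
    (⇔-trans (CP-split ℕ.≤-refl (ℕ.m≤n+m (suc c) 2)) (mk⇔ (Sum.map₁ (Equivalence.to Irreducible-diagonal))
                                                         (Sum.map₁ (Equivalence.from Irreducible-diagonal))))
    (λ (_ , _ , Gc≡0) → ¬Shifted-G Gc≡0)

  [1-Xc+1Yc]-⊛-𝟙CP : (oneMinus (Xm (suc c) · Ym c) ⊛ 𝟙 (CP? (suc c) c)) ≐ 𝟙 (Irreducible? (suc c) c)
  [1-Xc+1Yc]-⊛-𝟙CP = oneMinus-⊛-split (XY-realises c<n c≤n) (CP-ext (suc c) c) (CP? (suc c) c) (Irreducible? (suc c) c)
    (CP-split (ℕ.n≤1+n c) (s≤s (ℕ.n≤1+n c))) Irreducible⇒¬Shifted

  [1-Xc+1Yc-1]-⊛-𝟙Irreducible : (oneMinus (Xm (suc c) · Ym (c ∸ 1)) ⊛ 𝟙 (Irreducible? (suc c) c)) ≐ (oneMinus (numerator c) ⊛ 𝟙 (CP? c c))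
  [1-Xc+1Yc-1]-⊛-𝟙Irreducible a b = begin
    (oneMinus (Xm (suc c) · Ym (c ∸ 1)) ⊛ 𝟙 I?) a b  ≡⟨ oneMinus-⊛-𝟙 XY≈ (Irreducible-ext (suc c) c) I? a b ⟩
    𝟙 I? a b - 𝟙 SI? a b                             ≡⟨ last-factor c (decide I? a b) (decide SI? a b) (decide P? a b) (decide SP? a b) ⟩
    𝟙 P? a b - 𝟙 SP? a b                             ≡⟨ oneMinus-⊛-𝟙 numerator≈ (CP-ext c c) P? a b ⟨
    (oneMinus (numerator c) ⊛ 𝟙 P?) a b              ∎
    where
    open ≡-Reasoning
    XY≈ = XY-realises c<n (ℕ.≤-trans (ℕ.m∸n≤m c 1) c≤n)
    numerator≈ = numerator-realises c<n
    I?  = Irreducible? (suc c) c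
    P?  = CP? c c
    SI? = shifted? XY≈ (Irreducible-ext (suc c) c) I?
    SP? = shifted? numerator≈ (CP-ext c c) P?

module _ {c ℓ} (M : Monoid c ℓ) where

  open Monoid M
  open import Relation.Binary.Reasoning.Setoid setoid

  telescope : (q f : ℕ → Carrier) (k : ℕ) → (∀ i → i < k → q i ∙ f i ≈ q (suc i)) →
              q 0 ∙ foldr _∙_ ε (applyUpTo f k) ≈ q k
  telescope q f zero    _    = identityʳ (q 0)
  telescope q f (suc k) step = begin
    q 0 ∙ (f 0 ∙ foldr _∙_ ε (applyUpTo (f ∘ suc) k))   ≈⟨ assoc (q 0) (f 0) _ ⟨
    (q 0 ∙ f 0) ∙ foldr _∙_ ε (applyUpTo (f ∘ suc) k)   ≈⟨ ∙-congʳ (step 0 (s≤s z≤n)) ⟩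
    q 1 ∙ foldr _∙_ ε (applyUpTo (f ∘ suc) k)           ≈⟨ telescope (q ∘ suc) (f ∘ suc) k (λ i i<k → step (suc i) (s≤s i<k)) ⟩
    q (suc k)                                           ∎

𝟙CP-⊛-factor : {n c : ℕ} → suc c ≤ suc n → (𝟙 (CP? c c) ⊛ factor (suc n) (suc c)) ≐ 𝟙 (CP? (suc c) (suc c))
𝟙CP-⊛-factor {n} {c} c<n = begin
  P ∙ (N ∙ (G₁ ∙ (G₂ ∙ G₃)))                 ≈⟨ x∙yz≈yx∙z P N (G₁ ∙ (G₂ ∙ G₃)) ⟩
  (N ∙ P) ∙ (G₁ ∙ (G₂ ∙ G₃))                 ≈⟨ ∙-congʳ {G₁ ∙ (G₂ ∙ G₃)} numerator-identity ⟨
  (D₁ ∙ (D₂ ∙ (D₃ ∙ Q))) ∙ (G₁ ∙ (G₂ ∙ G₃))  ≈⟨ interchange D₁ (D₂ ∙ (D₃ ∙ Q)) G₁ (G₂ ∙ G₃) ⟩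
  (D₁ ∙ G₁) ∙ ((D₂ ∙ (D₃ ∙ Q)) ∙ (G₂ ∙ G₃))  ≈⟨ ∙-congˡ {D₁ ∙ G₁} (interchange D₂ (D₃ ∙ Q) G₂ G₃) ⟩
  (D₁ ∙ G₁) ∙ ((D₂ ∙ G₂) ∙ ((D₃ ∙ Q) ∙ G₃))  ≈⟨ ∙-congˡ {D₁ ∙ G₁} (∙-congˡ {D₂ ∙ G₂} (xy∙z≈xz∙y D₃ Q G₃)) ⟩
  (D₁ ∙ G₁) ∙ ((D₂ ∙ G₂) ∙ ((D₃ ∙ G₃) ∙ Q))  ≈⟨ ∙-cong (oneMinus-⊛-geom g₁ refl)
                                                   (∙-cong (oneMinus-⊛-geom g₂ refl) (∙-congʳ {Q} (oneMinus-⊛-geom g₃ refl))) ⟩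
  ε ∙ (ε ∙ (ε ∙ Q))                          ≈⟨ ≈-trans (identityˡ (ε ∙ (ε ∙ Q))) (≈-trans (identityˡ (ε ∙ Q)) (identityˡ Q)) ⟩
  Q                                          ∎
  where
  open CommutativeMonoid (⊛-commutativeMonoid (suc n))
    using (_∙_; _≈_; ε; ∙-cong; ∙-congˡ; ∙-congʳ; identityˡ; setoid; commutativeSemigroup) renaming (trans to ≈-trans)
  open import Algebra.Properties.CommutativeSemigroup commutativeSemigroup using (interchange; x∙yz≈yx∙z; xy∙z≈xz∙y)
  open import Relation.Binary.Reasoning.Setoid setoid
  g₁ = Xm (suc c) · Ym (c ∸ 1)
  g₂ = Xm (suc c) · Ym c
  g₃ = Xm (suc c) · Ym (suc c)
  D₁ = oneMinus g₁
  D₂ = oneMinus g₂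
  D₃ = oneMinus g₃
  G₁ = geom g₁
  G₂ = geom g₂
  G₃ = geom g₃
  N = oneMinus (numerator c)
  P = 𝟙 (CP? c c)
  Q = 𝟙 (CP? (suc c) (suc c))
  numerator-identity : D₁ ∙ (D₂ ∙ (D₃ ∙ Q)) ≈ N ∙ P
  numerator-identity = ≈-trans (∙-congˡ {D₁} (∙-congˡ {D₂} ([1-Xc+1Yc+1]-⊛-𝟙CP c<n)))
                      (≈-trans (∙-congˡ {D₁} ([1-Xc+1Yc]-⊛-𝟙CP c<n)) ([1-Xc+1Yc-1]-⊛-𝟙Irreducible c<n))

theorem3p4 : (n : ℕ) → n ≥ 1 → (a b : Vec ℕ n) → CP20 n a b ≡ RHS n a b
theorem3p4 (suc n) _ a b = begin
  CP20 (suc n) a b                        ≡⟨ CP20≐𝟙CP (suc n) a b ⟩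
  𝟙 (CP? (suc n) (suc n)) a b             ≡⟨ telescope (CommutativeMonoid.monoid (⊛-commutativeMonoid (suc n)))
                                               (λ c → 𝟙 (CP? c c)) factors (suc n) (λ c c<n → 𝟙CP-⊛-factor c<n) a b ⟨
  (𝟙 (CP? 0 0) ⊛ ∏factors) a b            ≡⟨ ⊛-cong {g = ∏factors} {∏factors} (oneS≐𝟙CP (suc n)) (λ _ _ → refl) a b ⟨
  (oneS ⊛ ∏factors) a b                   ≡⟨ ⊛-identityˡ ∏factors a b ⟩
  ∏factors a b                            ≡⟨ cong (λ fs → foldr _⊛_ oneS fs a b) (map-upTo factors (suc n)) ⟨
  RHS (suc n) a b                         ∎
  where
  open ≡-Reasoning
  factors = λ i → factor (suc n) (suc i)
  ∏factors = foldr _⊛_ oneS (applyUpTo factors (suc n))
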